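{- Let $p$ be an odd prime, let $f_1,\dots,f_n\subseteq[n]\cup\{ -\}$ satisfy $f_j\in V_{\{j\}}$, $j\notin f_j$ and $|\{i\}\cap f_j| = |\{j\}\cap f_i|$ for all $i,j\in[n]$. Let $t_i = p^{\lambda_i}u_i$ with $\lambda_i\in\mathbb{Z}_{\geq0}$ and $u_i\in\mathbb{Z}_p^\times$ for $i\in[n]$, and let $T = \{i\in[n] : \lambda_i\equiv 1\bmod 2\}$. Then \[ \prod_{\{i,j\}\subseteq[n]}(t_i,t_j)_p^{|\{i\}\cap f_j|} = \prod_{\{i,j\}\subseteq T}(-1,p)_p^{|\{i\}\cap f_j|}\prod_{i\in[n]}(u_i,p)_p^{|\{i\}\cap f(T)|}. \]
   Context: Setting: integers $n \geq 2$, $m \geq 1$ and squarefree monomials $M_{i,j}(t_1,\dots,t_n)$ ($i \in [m]$, $j \in \{1,2,3\}$, $[n]=\{1,\dots,n\}$) with leading coefficient $\pm1$, with $M_{i,1},M_{i,2},M_{i,3}$ pairwise coprime for each $i$. View $\mathcal{P}([n]\cup\{ -\})$ ($-$ a formal symbol) as an $\mathbb{F}_2$-vector space under symmetric difference $+$. Encode a monomial $\pm\prod_{l\in S'}t_l$ as $S'$ (sign $+$) or $S'\cup\{ -\}$ (sign $-$); let $S_{i,k}$ encode $M_{i,k}$. For $j\in[n]$ put $g_{i,\{j\}} = \varnothing$ if $j\notin S_{i,1}\cup S_{i,2}\cup S_{i,3}$, and $g_{i,\{j\}} = \{ -\}+S_{i,k'}+S_{i,k''}$ if $j \in S_{i,k}$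 where $\{k,k',k''\}=\{1,2,3\}$. Let $V_{\{j\}}$ be the span of $\{g_{i,\{j\}}: i\in[m]\}$. $(\cdot,\cdot)_p$ is the $p$-adic Hilbert symbol; products over $\{i,j\}$ run over unordered pairs of distinct elements. For $T\subseteq[n]$ and $i\in[n]$, $|\{i\}\cap f(T)|$ denotes $\sum_{j\in T}|\{i\}\cap f_j| \bmod 2$ (i.e. the membership of $i$ in the symmetric difference of the $f_j$, $j\in T$). -}

module Defs where

open import Data.Bool using (Bool; true; false; _xor_; if_then_else_; not)
open import Data.Nat using (ℕ; zero; suc; _^_)
open import Data.Nat.Divisibility as ℕD using (_∣0)
open import Data.Integer using (ℤ; +_; -_; _-_; _*_; _+_; 1ℤ; -1ℤ)
open import Data.Integer.Divisibility using (_∣_)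
open import Data.Integer.Properties using (i≡j⇒i-j≡0)
open import Data.Fin using (Fin; zero; suc; _<_)
open import Data.Fin.Subset using (Subset; _∈_; _∉_)
open import Data.Vec using (Vec; lookup; zipWith; replicate)
open import Data.Product using (_×_; _,_; ∃; Σ; proj₁; proj₂)
open import Data.Sum using (_⊎_)
open import Data.Empty using (⊥)
open import Relation.Nullary using (¬_; does)
open import Relation.Binary.PropositionalEquality using (_≡_; refl; subst; sym)
open import Data.Fin.Subset.Properties using (_∈?_)
open import Data.Fin using (_<?_)

-- p-adic integers, as the inverse limit  Z_p = lim Z / p^k :
-- a p-adic integer is a coherent sequence of integers
-- (seq k is a representative of the residue mod p^k).

record ℤₚ (p : ℕ) : Set where
  field
    seq : ℕ → ℤ
    coh : ∀ k → (+ (p ^ k)) ∣ (seq (suc k) - seq k)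
open ℤₚ public

ι : (p : ℕ) → ℤ → ℤₚ p
ι p c = record { seq = λ _ → c
               ; coh = λ k → subst (λ e → (+ (p ^ k)) ∣ e) (sym (i≡j⇒i-j≡0 {c} refl)) ((p ^ k) ∣0) }

IsZero : {p : ℕ} → ℤₚ p → Set
IsZero {p} x = ∀ k → (+ (p ^ k)) ∣ seq x k

IsUnit : {p : ℕ} → ℤₚ p → Set
IsUnit {p} x = ∃ λ (y : ℤₚ p) → ∀ k → (+ (p ^ k)) ∣ (seq x k * seq y k - 1ℤ)

IsPowTimes : {p : ℕ} → ℤₚ p → ℕ → ℤₚ p → Set
IsPowTimes {p} x l u = ∀ k → (+ (p ^ k)) ∣ (seq x k - (+ (p ^ l)) * seq u k)

-- z² = a x² + b y² has a non-trivial solution (x,y,z) (over Z_p, which for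
-- a homogeneous equation is the same as over Q_p)
HilbertSolvable : {p : ℕ} → ℤₚ p → ℤₚ p → Set
HilbertSolvable {p} a b =
  ∃ λ (x : ℤₚ p) → ∃ λ (y : ℤₚ p) → ∃ λ (z : ℤₚ p) →
    (¬ (IsZero x × IsZero y × IsZero z)) ×
    (∀ k → (+ (p ^ k)) ∣ (seq a k * (seq x k * seq x k) + seq b k * (seq y k * seq y k)
                           - seq z k * seq z k))

IsHilbertSymbol : {p : ℕ} → ℤₚ p → ℤₚ p → ℤ → Set
IsHilbertSymbol a b s = (s ≡ 1ℤ × HilbertSolvable a b) ⊎ (s ≡ -1ℤ × ¬ HilbertSolvable a b)

-- F_2-vector space P([n] ∪ {-}) : an element is (membership of -, subset of [n]),
-- with [n] represented by Fin n; addition is symmetric difference.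

Elt : ℕ → Set
Elt n = Bool × Subset n

_⊕_ : {n : ℕ} → Elt n → Elt n → Elt n
(a , A) ⊕ (b , B) = (a xor b , zipWith _xor_ A B)

𝟘 : {n : ℕ} → Elt n
𝟘 {n} = (false , replicate n false)

minusE : {n : ℕ} → Elt n
minusE {n} = (true , replicate n false)

memb : {n : ℕ} → Fin n → Elt n → Bool
memb j (_ , A) = lookup A j

-- the monomials M_{i,k} are given by their encodings S i k
Encodings : ℕ → ℕ → Set
Encodings m n = Fin m → Fin 3 → Elt n

PairwiseCoprime : {m n : ℕ} → Encodings m n → Set
PairwiseCoprime {m} {n} S = ∀ (i : Fin m) (k k' : Fin 3) → ¬ (k ≡ k') →
  ∀ (j : Fin n) → ¬ (memb j (S i k) ≡ true × memb j (S i k') ≡ true)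

g : {m n : ℕ} → Encodings m n → Fin m → Fin n → Elt n
g S i j =
  if memb j (S i zero) then minusE ⊕ (S i (suc zero) ⊕ S i (suc (suc zero)))
  else if memb j (S i (suc zero)) then minusE ⊕ (S i zero ⊕ S i (suc (suc zero)))
  else if memb j (S i (suc (suc zero))) then minusE ⊕ (S i zero ⊕ S i (suc zero))
  else 𝟘

lincomb : {m n : ℕ} → (Fin m → Bool) → (Fin m → Elt n) → Elt n
lincomb {zero} c v = 𝟘
lincomb {suc m} c v = (if c zero then v zero else 𝟘) ⊕ lincomb (λ i → c (suc i)) (λ i → v (suc i))

InV : {m n : ℕ} → Encodings m n → Fin n → Elt n → Set
InV {m} S j f = ∃ λ (c : Fin m → Bool) → lincomb c (λ i → g S i j) ≡ f

prodFin : (n : ℕ) → (Fin n → ℤ) → ℤ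
prodFin zero h = 1ℤ
prodFin (suc n) h = h zero * prodFin n (λ i → h (suc i))

prodPairs : (n : ℕ) → (Fin n → Fin n → ℤ) → ℤ
prodPairs n h = prodFin n (λ i → prodFin n (λ j → if does (i <? j) then h i j else 1ℤ))

pow01 : ℤ → Bool → ℤ
pow01 x true = x
pow01 x false = 1ℤ

xorSum : (n : ℕ) → (Fin n → Bool) → Bool
xorSum zero _ = false
xorSum (suc n) b = b zero xor xorSum n (λ i → b (suc i))

isOdd : ℕ → Bool
isOdd zero = false
isOdd (suc n) = not (isOdd n)

-- For t = p^λ u with u a unit, solvability of z² = t x² + t′ y² only depends on λ, λ′ mod 2 (rescaling the
-- solution moves factors p² in and out) and on u, u′ mod p: Hensel's lemma lifts solutions mod p, and a
-- descent shows that when the reduction mod p has no suitable solution every p-adic solution is divisible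
-- by arbitrarily high powers of p. Together with the multiplicativity of being a square mod p this gives
-- (t, t′)_p = (−1, p)_p^(λλ′) (u′, p)_p^λ (u, p)_p^λ′. Inserting this into the product over pairs {i, j},
-- the factors (u_i, p)_p^(λ_j f_ij) and (u_j, p)_p^(λ_i f_ij) combine, by f_ij = f_ji and f_ii = 0, into
-- the product over i of (u_i, p)_p^(Σ_j λ_j f_ij).
module Submission where

open import Defs
import Data.Integer.Properties as Intₚ
open import Algebra.Properties.CommutativeSemigroup Intₚ.*-commutativeSemigroup using ()
  renaming (interchange to *-interchange)
open import Data.Bool using (Bool; true; false; _∧_; _xor_; if_then_else_)
import Data.Bool.Properties as Boolₚ
open import Data.Empty using (⊥-elim)
open import Data.Fin as Fin using (Fin; toℕ; fromℕ<; _<?_)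
import Data.Fin.Properties as Finₚ
open import Data.Integer as ℤ using (ℤ; +_; -_; _-_; _+_; _*_; 0ℤ; 1ℤ; -1ℤ; ∣_∣)
import Data.Integer.DivMod as ℤ÷
open import Data.Integer.Divisibility.Signed as ℤ∣ using (divides) renaming (_∣_ to _∣ℤ_)
open import Data.Integer.Tactic.RingSolver using (solve-∀)
open import Data.Nat as ℕ using (ℕ; zero; suc; _≤_; _^_)
open import Data.Nat.Divisibility as ℕ∣ using (_∣_)
import Data.Nat.Properties as ℕₚ
open import Data.Nat.Primality using (Prime; euclidsLemma; prime⇒nonZero; prime⇒nonTrivial)
open import Data.Product using (Σ; _×_; _,_; proj₁; proj₂)
open import Data.Sum using (_⊎_; inj₁; inj₂; [_,_]′; reduce)
open import Function using (_∘_)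
open import Function.Bundles using (_⇔_; mk⇔; module Equivalence)
open import Function.Construct.Composition using (_⇔-∘_)
open import Function.Construct.Symmetry using (⇔-sym)
open import Function.Properties.Equivalence using (⇔-setoid)
import Level
import Relation.Binary.Reasoning.Setoid as SetoidReasoning
open import Relation.Binary.Definitions using (tri<; tri≈; tri>)
open import Relation.Binary.PropositionalEquality
open import Relation.Nullary using (¬_; yes; no; Dec; does)
open import Relation.Nullary.Decidable using (dec-true; dec-false; map′; decidable-stable)

module ⇔-Reasoning = SetoidReasoning (⇔-setoid Level.zero)

∣-by-multiple : ∀ {d} E α X → E ≡ α * X → d ∣ℤ X → d ∣ℤ E
∣-by-multiple E α X refl d∣X = ℤ∣.∣n⇒∣m*n α d∣X

∣-by-sum : ∀ {d} E X Y → E ≡ X + Y → d ∣ℤ X → d ∣ℤ Y → d ∣ℤ E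
∣-by-sum E X Y refl = ℤ∣.∣m∣n⇒∣m+n

∣-by-difference : ∀ {d} E X Y → E ≡ X - Y → d ∣ℤ X → d ∣ℤ Y → d ∣ℤ E
∣-by-difference E X Y refl = ℤ∣.∣m∣n⇒∣m-n

∣-by-combination₂ : ∀ {d} E α X β Y → E ≡ α * X + β * Y → d ∣ℤ X → d ∣ℤ Y → d ∣ℤ E
∣-by-combination₂ E α X β Y refl d∣X d∣Y =
  ℤ∣.∣m∣n⇒∣m+n (ℤ∣.∣n⇒∣m*n α d∣X) (ℤ∣.∣n⇒∣m*n β d∣Y)

∣-by-combination₃ : ∀ {d} E α X β Y γ Z → E ≡ α * X + β * Y + γ * Z →
                    d ∣ℤ X → d ∣ℤ Y → d ∣ℤ Z → d ∣ℤ E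
∣-by-combination₃ E α X β Y γ Z refl d∣X d∣Y d∣Z =
  ℤ∣.∣m∣n⇒∣m+n (∣-by-combination₂ _ α X β Y refl d∣X d∣Y) (ℤ∣.∣n⇒∣m*n γ d∣Z)

∣-diff-refl : ∀ {d} a → d ∣ℤ a - a
∣-diff-refl a = divides 0ℤ (Intₚ.+-inverseʳ a)

∣-diff-comm : ∀ {d a b} → d ∣ℤ a - b → d ∣ℤ b - a
∣-diff-comm {a = a} {b} = ∣-by-multiple (b - a) -1ℤ (a - b) (flip-diff a b)
  where
    flip-diff : ∀ a b → b - a ≡ -1ℤ * (a - b)
    flip-diff = solve-∀

1∣ : ∀ a → + 1 ∣ℤ a
1∣ a = divides a (sym (Intₚ.*-identityʳ a))

*-pres-∣ : ∀ {d e a b} → d ∣ℤ a → e ∣ℤ b → d * e ∣ℤ a * b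
*-pres-∣ {d} {e} (divides q refl) (divides r refl) = divides (q * r) (*-interchange q d r e)

odd⇒≡1+2* : ∀ n → ¬ 2 ∣ n → Σ ℕ λ h → n ≡ suc (h ℕ.+ h)
odd⇒≡1+2* zero 2∤0 = ⊥-elim (2∤0 (ℕ∣.divides 0 refl))
odd⇒≡1+2* (suc zero) _ = 0 , refl
odd⇒≡1+2* (suc (suc n)) 2∤n+2 with odd⇒≡1+2* n (2∤n+2 ∘ ℕ∣.∣m∣n⇒∣m+n ℕ∣.∣-refl)
... | h , refl = suc h , cong (suc ∘ suc) (sym (ℕₚ.+-suc h h))

quadratic-form-scale : ∀ {a b x y z X Y Z q} → x ≡ X * q → y ≡ Y * q → z ≡ Z * q →
  a * (x * x) + b * (y * y) - z * z ≡ q * q * (a * (X * X) + b * (Y * Y) - Z * Z)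
quadratic-form-scale {a} {b} {X = X} {Y} {Z} {q} refl refl refl = scaling a b X Y Z q
  where
    scaling : ∀ a b X Y Z q →
      a * (X * q * (X * q)) + b * (Y * q * (Y * q)) - Z * q * (Z * q) ≡ q * q * (a * (X * X) + b * (Y * Y) - Z * Z)
    scaling = solve-∀

<⇒splitAt-≢ : ∀ {m n} {i j : Fin (m ℕ.+ n)} → i Fin.< j → Fin.splitAt m i ≢ Fin.splitAt m j
<⇒splitAt-≢ {m} {n} {i} {j} i<j eq =
  Finₚ.<⇒≢ i<j (trans (sym (Finₚ.join-splitAt m n i)) (trans (cong (Fin.join m n) eq) (Finₚ.join-splitAt m n j)))

-- IsHilbertSymbol a b s unfolds to Sign s (HilbertSolvable a b).
Sign : ℤ → Set → Set
Sign s A = (s ≡ 1ℤ × A) ⊎ (s ≡ -1ℤ × ¬ A)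

Sign-resp-⇔ : ∀ {s A B} → A ⇔ B → Sign s A → Sign s B
Sign-resp-⇔ A⇔B (inj₁ (s≡1 , a)) = inj₁ (s≡1 , Equivalence.to A⇔B a)
Sign-resp-⇔ A⇔B (inj₂ (s≡-1 , ¬a)) = inj₂ (s≡-1 , ¬a ∘ Equivalence.from A⇔B)

Sign-unique : ∀ {s t A B} → A ⇔ B → Sign s A → Sign t B → s ≡ t
Sign-unique A⇔B (inj₁ (refl , _)) (inj₁ (refl , _)) = refl
Sign-unique A⇔B (inj₁ (_ , a)) (inj₂ (_ , ¬b)) = ⊥-elim (¬b (Equivalence.to A⇔B a))
Sign-unique A⇔B (inj₂ (_ , ¬a)) (inj₁ (_ , b)) = ⊥-elim (¬a (Equivalence.from A⇔B b))
Sign-unique A⇔B (inj₂ (refl , _)) (inj₂ (refl , _)) = refl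

Sign-true : ∀ {s A} → A → Sign s A → s ≡ 1ℤ
Sign-true _ (inj₁ (s≡1 , _)) = s≡1
Sign-true a (inj₂ (_ , ¬a)) = ⊥-elim (¬a a)

Sign-* : ∀ {s t A B} → Sign s A → Sign t B → Sign (s * t) (A ⇔ B)
Sign-* (inj₁ (refl , a)) (inj₁ (refl , b)) = inj₁ (refl , mk⇔ (λ _ → b) (λ _ → a))
Sign-* (inj₁ (refl , a)) (inj₂ (refl , ¬b)) = inj₂ (refl , λ a⇔b → ¬b (Equivalence.to a⇔b a))
Sign-* (inj₂ (refl , ¬a)) (inj₁ (refl , b)) = inj₂ (refl , λ a⇔b → ¬a (Equivalence.from a⇔b b))
Sign-* (inj₂ (refl , ¬a)) (inj₂ (refl , ¬b)) = inj₁ (refl , mk⇔ (⊥-elim ∘ ¬a) (⊥-elim ∘ ¬b))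

Sign⇒s*s≡1 : ∀ {s A} → Sign s A → s * s ≡ 1ℤ
Sign⇒s*s≡1 (inj₁ (refl , _)) = refl
Sign⇒s*s≡1 (inj₂ (refl , _)) = refl

prodFin-cong : ∀ n {h h′ : Fin n → ℤ} → (∀ i → h i ≡ h′ i) → prodFin n h ≡ prodFin n h′
prodFin-cong zero h≡h′ = refl
prodFin-cong (suc n) h≡h′ = cong₂ _*_ (h≡h′ Fin.zero) (prodFin-cong n (h≡h′ ∘ Fin.suc))

prodFin-* : ∀ n (h k : Fin n → ℤ) → prodFin n (λ i → h i * k i) ≡ prodFin n h * prodFin n k
prodFin-* zero h k = refl
prodFin-* (suc n) h k = begin
  h₀ * k₀ * prodFin n (λ i → h (Fin.suc i) * k (Fin.suc i))
    ≡⟨ cong (h₀ * k₀ *_) (prodFin-* n (h ∘ Fin.suc) (k ∘ Fin.suc)) ⟩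
  h₀ * k₀ * (prodFin n (h ∘ Fin.suc) * prodFin n (k ∘ Fin.suc))
    ≡⟨ *-interchange h₀ k₀ _ _ ⟩
  h₀ * prodFin n (h ∘ Fin.suc) * (k₀ * prodFin n (k ∘ Fin.suc)) ∎
  where
    open ≡-Reasoning
    h₀ = h Fin.zero
    k₀ = k Fin.zero

prodFin-1 : ∀ n → prodFin n (λ _ → 1ℤ) ≡ 1ℤ
prodFin-1 zero = refl
prodFin-1 (suc n) = trans (Intₚ.*-identityˡ _) (prodFin-1 n)

prodFin-comm : ∀ n m (h : Fin n → Fin m → ℤ) →
  prodFin n (λ i → prodFin m (h i)) ≡ prodFin m (λ j → prodFin n (λ i → h i j))
prodFin-comm zero m h = sym (prodFin-1 m)
prodFin-comm (suc n) m h =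
  trans (cong (prodFin m (h Fin.zero) *_) (prodFin-comm n m (h ∘ Fin.suc)))
        (sym (prodFin-* m (h Fin.zero) (λ j → prodFin n (λ i → h (Fin.suc i) j))))

pow01-* : ∀ a b e → pow01 (a * b) e ≡ pow01 a e * pow01 b e
pow01-* a b true = refl
pow01-* a b false = refl

pow01-pow01 : ∀ x a b → pow01 (pow01 x a) b ≡ pow01 x (a ∧ b)
pow01-pow01 x true b = refl
pow01-pow01 x false true = refl
pow01-pow01 x false false = refl

pow01-xor : ∀ {x} → x * x ≡ 1ℤ → ∀ a b → pow01 x (a xor b) ≡ pow01 x a * pow01 x b
pow01-xor x²≡1 true true = sym x²≡1
pow01-xor {x} x²≡1 true false = sym (Intₚ.*-identityʳ x)
pow01-xor {x} x²≡1 false true = sym (Intₚ.*-identityˡ x)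
pow01-xor x²≡1 false false = refl

pow01-xorSum : ∀ {x} → x * x ≡ 1ℤ → ∀ n (e : Fin n → Bool) →
  pow01 x (xorSum n e) ≡ prodFin n (λ j → pow01 x (e j))
pow01-xorSum x²≡1 zero e = refl
pow01-xorSum x²≡1 (suc n) e =
  trans (pow01-xor x²≡1 (e Fin.zero) (xorSum n (e ∘ Fin.suc)))
        (cong (pow01 _ (e Fin.zero) *_) (pow01-xorSum x²≡1 n (e ∘ Fin.suc)))

-- prodPairs n h unfolds to prodFin n (λ i → prodFin n (λ j → when< i j (h i j))).
when< : ∀ {n} → Fin n → Fin n → ℤ → ℤ
when< i j x = if does (i <? j) then x else 1ℤ

when<-* : ∀ {n} (i j : Fin n) a b → when< i j (a * b) ≡ when< i j a * when< i j b
when<-* i j a b with does (i <? j)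
... | true = refl
... | false = refl

when<-yes : ∀ {n} {i j : Fin n} x → i Fin.< j → when< i j x ≡ x
when<-yes {i = i} {j} x i<j = cong (if_then x else 1ℤ) (dec-true (i <? j) i<j)

when<-no : ∀ {n} {i j : Fin n} x → ¬ i Fin.< j → when< i j x ≡ 1ℤ
when<-no {i = i} {j} x i≮j = cong (if_then x else 1ℤ) (dec-false (i <? j) i≮j)

when<-split : ∀ {n} (i j : Fin n) x → (i ≡ j → x ≡ 1ℤ) → x ≡ when< i j x * when< j i x
when<-split i j x diag with Finₚ.<-cmp i j
... | tri< i<j _ j≮i = sym (trans (cong₂ _*_ (when<-yes x i<j) (when<-no x j≮i)) (Intₚ.*-identityʳ x))
... | tri≈ i≮j i≡j j≮i = trans (diag i≡j) (sym (cong₂ _*_ (when<-no x i≮j) (when<-no x j≮i)))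
... | tri> i≮j _ j<i = sym (trans (cong₂ _*_ (when<-no x i≮j) (when<-yes x j<i)) (Intₚ.*-identityˡ x))

prodPairs-cong : ∀ n {h h′ : Fin n → Fin n → ℤ} → (∀ i j → h i j ≡ h′ i j) →
                 prodPairs n h ≡ prodPairs n h′
prodPairs-cong n h≡h′ = prodFin-cong n (λ i → prodFin-cong n (λ j → cong (when< i j) (h≡h′ i j)))

prodPairs-* : ∀ n (h k : Fin n → Fin n → ℤ) →
  prodPairs n (λ i j → h i j * k i j) ≡ prodPairs n h * prodPairs n k
prodPairs-* n h k =
  trans (prodFin-cong n (λ i → trans (prodFin-cong n (λ j → when<-* i j (h i j) (k i j)))
                                     (prodFin-* n (λ j → when< i j (h i j)) (λ j → when< i j (k i j)))))
        (prodFin-* n (λ i → prodFin n (λ j → when< i j (h i j))) (λ i → prodFin n (λ j → when< i j (k i j))))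

prodFin²≡prodPairs*prodPairsᵀ : ∀ n (h : Fin n → Fin n → ℤ) → (∀ i → h i i ≡ 1ℤ) →
  prodFin n (λ i → prodFin n (h i)) ≡ prodPairs n h * prodPairs n (λ i j → h j i)
prodFin²≡prodPairs*prodPairsᵀ n h diag = begin
  prodFin n (λ i → prodFin n (h i))
    ≡⟨ prodFin-cong n (λ i → prodFin-cong n (λ j → when<-split i j (h i j) (λ { refl → diag i }))) ⟩
  prodFin n (λ i → prodFin n (λ j → when< i j (h i j) * when< j i (h i j)))
    ≡⟨ prodFin-cong n (λ i → prodFin-* n _ _) ⟩
  prodFin n (λ i → prodFin n (λ j → when< i j (h i j)) * prodFin n (λ j → when< j i (h i j)))
    ≡⟨ prodFin-* n _ _ ⟩
  prodPairs n h * prodFin n (λ i → prodFin n (λ j → when< j i (h i j)))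
    ≡⟨ cong (prodPairs n h *_) (prodFin-comm n n _) ⟩
  prodPairs n h * prodPairs n (λ i j → h j i) ∎
  where open ≡-Reasoning

prodPairs-regroup-symbols :
  ∀ n (o : Fin n → Bool) (e : Fin n → Fin n → Bool) (c : ℤ) (d : Fin n → ℤ) →
  (∀ i → d i * d i ≡ 1ℤ) → (∀ i j → e i j ≡ e j i) → (∀ i → e i i ≡ false) →
  prodPairs n (λ i j → pow01 (pow01 c (o i ∧ o j) * pow01 (d j) (o i) * pow01 (d i) (o j)) (e i j))
    ≡ prodPairs n (λ i j → pow01 c (o i ∧ o j ∧ e i j))
      * prodFin n (λ i → pow01 (d i) (xorSum n (λ j → o j ∧ e i j)))
prodPairs-regroup-symbols n o e c d d²≡1 e-sym e-diag = begin
  prodPairs n (λ i j → pow01 (pow01 c (o i ∧ o j) * pow01 (d j) (o i) * pow01 (d i) (o j)) (e i j))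
    ≡⟨ prodPairs-cong n expand ⟩
  prodPairs n (λ i j → C i j * Dᵀ i j * D i j)
    ≡⟨ prodPairs-* n (λ i j → C i j * Dᵀ i j) D ⟩
  prodPairs n (λ i j → C i j * Dᵀ i j) * prodPairs n D
    ≡⟨ cong (_* prodPairs n D) (prodPairs-* n C Dᵀ) ⟩
  prodPairs n C * prodPairs n Dᵀ * prodPairs n D
    ≡⟨ Intₚ.*-assoc (prodPairs n C) _ _ ⟩
  prodPairs n C * (prodPairs n Dᵀ * prodPairs n D)
    ≡⟨ cong (prodPairs n C *_) (Intₚ.*-comm (prodPairs n Dᵀ) _) ⟩
  prodPairs n C * (prodPairs n D * prodPairs n Dᵀ)
    ≡⟨ cong (prodPairs n C *_) (sym d-factor) ⟩
  prodPairs n C * prodFin n (λ i → pow01 (d i) (xorSum n (λ j → o j ∧ e i j))) ∎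
  where
    open ≡-Reasoning
    C D Dᵀ : Fin n → Fin n → ℤ
    C i j = pow01 c (o i ∧ o j ∧ e i j)
    D i j = pow01 (d i) (o j ∧ e i j)
    Dᵀ i j = pow01 (d j) (o i ∧ e i j)

    expand : ∀ i j → pow01 (pow01 c (o i ∧ o j) * pow01 (d j) (o i) * pow01 (d i) (o j)) (e i j)
                     ≡ C i j * Dᵀ i j * D i j
    expand i j = begin
      pow01 (pow01 c (o i ∧ o j) * pow01 (d j) (o i) * pow01 (d i) (o j)) (e i j)
        ≡⟨ pow01-* (pow01 c (o i ∧ o j) * pow01 (d j) (o i)) _ (e i j) ⟩
      pow01 (pow01 c (o i ∧ o j) * pow01 (d j) (o i)) (e i j) * pow01 (pow01 (d i) (o j)) (e i j)
        ≡⟨ cong (_* _) (pow01-* (pow01 c (o i ∧ o j)) _ (e i j)) ⟩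
      pow01 (pow01 c (o i ∧ o j)) (e i j) * pow01 (pow01 (d j) (o i)) (e i j) * pow01 (pow01 (d i) (o j)) (e i j)
        ≡⟨ cong₂ _*_ (cong₂ _*_ (trans (pow01-pow01 c (o i ∧ o j) (e i j))
                                       (cong (pow01 c) (Boolₚ.∧-assoc (o i) (o j) (e i j))))
                                (pow01-pow01 (d j) (o i) (e i j)))
                     (pow01-pow01 (d i) (o j) (e i j)) ⟩
      C i j * Dᵀ i j * D i j ∎

    d-factor : prodFin n (λ i → pow01 (d i) (xorSum n (λ j → o j ∧ e i j))) ≡ prodPairs n D * prodPairs n Dᵀ
    d-factor = begin
      prodFin n (λ i → pow01 (d i) (xorSum n (λ j → o j ∧ e i j)))
        ≡⟨ prodFin-cong n (λ i → pow01-xorSum (d²≡1 i) n (λ j → o j ∧ e i j)) ⟩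
      prodFin n (λ i → prodFin n (D i))
        ≡⟨ prodFin²≡prodPairs*prodPairsᵀ n D D-diag ⟩
      prodPairs n D * prodPairs n (λ i j → D j i)
        ≡⟨ cong (prodPairs n D *_) (prodPairs-cong n (λ i j → cong (λ b → pow01 (d j) (o i ∧ b)) (e-sym j i))) ⟩
      prodPairs n D * prodPairs n Dᵀ ∎
      where
        D-diag : ∀ i → D i i ≡ 1ℤ
        D-diag i rewrite e-diag i | Boolₚ.∧-zeroʳ (o i) = refl

-- Arithmetic modulo an odd prime

module OddPrime (p : ℕ) (p-prime : Prime p) (p-odd : ¬ 2 ∣ p) where

  P : ℤ
  P = + p

  instance
    p-nonZero : ℕ.NonZero p
    p-nonZero = prime⇒nonZero p-prime

  1<p : 1 ℕ.< p
  1<p = ℕ.nonTrivial⇒n>1 p {{prime⇒nonTrivial p-prime}}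

  P∣m*n⇒P∣m⊎P∣n : ∀ {m n} → P ∣ℤ m * n → P ∣ℤ m ⊎ P ∣ℤ n
  P∣m*n⇒P∣m⊎P∣n {m} {n} P∣mn =
    Data.Sum.map ℤ∣.∣ᵤ⇒∣ ℤ∣.∣ᵤ⇒∣
      (euclidsLemma ∣ m ∣ ∣ n ∣ p-prime (subst (p ℕ∣.∣_) (Intₚ.abs-* m n) (ℤ∣.∣⇒∣ᵤ P∣mn)))

  P∣m*m⇒P∣m : ∀ {m} → P ∣ℤ m * m → P ∣ℤ m
  P∣m*m⇒P∣m = reduce ∘ P∣m*n⇒P∣m⊎P∣n

  P∤m⇒P∤n⇒P∤m*n : ∀ {m n} → ¬ P ∣ℤ m → ¬ P ∣ℤ n → ¬ P ∣ℤ m * n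
  P∤m⇒P∤n⇒P∤m*n P∤m P∤n = [ P∤m , P∤n ]′ ∘ P∣m*n⇒P∣m⊎P∣n

  P∣m⇒∣m∣<p⇒m≡0 : ∀ {m} → P ∣ℤ m → ∣ m ∣ ℕ.< p → m ≡ 0ℤ
  P∣m⇒∣m∣<p⇒m≡0 {m} P∣m ∣m∣<p with ∣ m ∣ in ∣m∣≡
  ... | zero = Intₚ.∣i∣≡0⇒i≡0 ∣m∣≡
  ... | suc _ = ⊥-elim (ℕₚ.<⇒≱ ∣m∣<p (ℕ∣.∣⇒≤ (subst (p ℕ∣.∣_) ∣m∣≡ (ℤ∣.∣⇒∣ᵤ P∣m))))

  P∤1 : ¬ P ∣ℤ 1ℤ
  P∤1 P∣1 with () ← P∣m⇒∣m∣<p⇒m≡0 P∣1 1<p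

  P∤-1 : ¬ P ∣ℤ -1ℤ
  P∤-1 = P∤1 ∘ ℤ∣.∣m⇒∣-m

  P∤2 : ¬ P ∣ℤ + 2
  P∤2 P∣2 = p-odd (subst (2 ∣_) (ℕₚ.≤-antisym 1<p (ℕ∣.∣⇒≤ (ℤ∣.∣⇒∣ᵤ P∣2))) ℕ∣.∣-refl)

  P∣? : ∀ m → Dec (P ∣ℤ m)
  P∣? m = map′ ℤ∣.∣ᵤ⇒∣ ℤ∣.∣⇒∣ᵤ (p ℕ∣.∣? ∣ m ∣)

  P∣i-j⇒i≡j : ∀ {i j} → i ℕ.< p → j ℕ.< p → P ∣ℤ + i - + j → i ≡ j
  P∣i-j⇒i≡j {i} {j} i<p j<p P∣i-j =
    Intₚ.+-injective (Intₚ.i-j≡0⇒i≡j (+ i) (+ j) (P∣m⇒∣m∣<p⇒m≡0 P∣i-j ∣i-j∣<p))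
    where
      ∣i-j∣<p : ∣ + i - + j ∣ ℕ.< p
      ∣i-j∣<p = subst (λ m → ∣ m ∣ ℕ.< p) (sym (Intₚ.m-n≡m⊖n i j))
                  (ℕₚ.≤-<-trans (Intₚ.∣m⊝n∣≤m⊔n i j) (ℕₚ.⊔-lub i<p j<p))

  residue : ℤ → Fin p
  residue a = fromℕ< (ℤ÷.n%ℕd<d a p)

  P∣m-residue : ∀ m → P ∣ℤ m - + toℕ (residue m)
  P∣m-residue m = divides (m ℤ÷./ℕ p) (begin
    m - + toℕ (residue m)    ≡⟨ cong (λ r → m - + r) (Finₚ.toℕ-fromℕ< (ℤ÷.n%ℕd<d m p)) ⟩
    m - r                    ≡⟨ cong (_- r) (ℤ÷.a≡a%ℕn+[a/ℕn]*n m p) ⟩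
    r + (m ℤ÷./ℕ p) * P - r  ≡⟨ cancel r (m ℤ÷./ℕ p * P) ⟩
    (m ℤ÷./ℕ p) * P          ∎)
    where
      open ≡-Reasoning
      r = + (m ℤ÷.%ℕ p)
      cancel : ∀ r x → r + x - r ≡ x
      cancel = solve-∀

  residue-≡⇒P∣- : ∀ a b → residue a ≡ residue b → P ∣ℤ a - b
  residue-≡⇒P∣- a b ra≡rb =
    ∣-by-difference (a - b) (a - r) (b - r) (shift a b r) (P∣m-residue a)
                    (subst (λ i → P ∣ℤ b - + toℕ i) (sym ra≡rb) (P∣m-residue b))
    where
      r = + toℕ (residue a)
      shift : ∀ a b r → a - b ≡ (a - r) - (b - r)
      shift = solve-∀

  pigeonhole-mod : ∀ {n} → p ℕ.< n → (f : Fin n → ℤ) →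
                   Σ (Fin n) λ i → Σ (Fin n) λ j → i Fin.< j × P ∣ℤ f i - f j
  pigeonhole-mod p<n f with Finₚ.pigeonhole p<n (residue ∘ f)
  ... | i , j , i<j , ri≡rj = i , j , i<j , residue-≡⇒P∣- (f i) (f j) ri≡rj

  -- Two of the p + 1 numbers 1, a·0, …, a·(p − 1) are congruent; it cannot be two of the a·i.
  inverse-mod : ∀ {a} → ¬ P ∣ℤ a → Σ ℤ λ a⁻¹ → P ∣ℤ a * a⁻¹ - 1ℤ
  inverse-mod {a} P∤a with pigeonhole-mod (ℕₚ.n<1+n p) f
    where
      f : Fin (suc p) → ℤ
      f Fin.zero = 1ℤ
      f (Fin.suc i) = a * + toℕ i
  ... | Fin.zero , Fin.suc j , _ , P∣1-aj = + toℕ j , ∣-diff-comm {a = 1ℤ} {a * + toℕ j} P∣1-aj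
  ... | Fin.suc i , Fin.suc j , i<j , P∣ai-aj
    with P∣m*n⇒P∣m⊎P∣n (∣-by-multiple _ 1ℤ (a * + toℕ i - a * + toℕ j)
                                        (factor a (+ toℕ i) (+ toℕ j)) P∣ai-aj)
    where
      factor : ∀ a i j → a * (i - j) ≡ 1ℤ * (a * i - a * j)
      factor = solve-∀
  ... | inj₁ P∣a = ⊥-elim (P∤a P∣a)
  ... | inj₂ P∣i-j = ⊥-elim (Finₚ.<⇒≢ (ℕ.s<s⁻¹ i<j)
                              (Finₚ.toℕ-injective (P∣i-j⇒i≡j (Finₚ.toℕ<n i) (Finₚ.toℕ<n j) P∣i-j)))

  half : ℕ
  half = proj₁ (odd⇒≡1+2* p p-odd)

  p≡1+2half : p ≡ suc (half ℕ.+ half)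
  p≡1+2half = proj₂ (odd⇒≡1+2* p p-odd)

  i≤half⇒i<p : ∀ {i} → i ≤ half → i ℕ.< p
  i≤half⇒i<p i≤half = subst (_ ℕ.<_) (sym p≡1+2half) (ℕ.s≤s (ℕₚ.≤-trans i≤half (ℕₚ.m≤m+n half half)))

  i+j<p : ∀ {i j} → i ≤ half → j ≤ half → i ℕ.+ j ℕ.< p
  i+j<p i≤half j≤half = subst (_ ℕ.<_) (sym p≡1+2half) (ℕ.s≤s (ℕₚ.+-mono-≤ i≤half j≤half))

  Square : ℤ → Set
  Square c = Σ ℤ λ w → P ∣ℤ c - w * w

  Square-resp : ∀ {a b} → P ∣ℤ a - b → Square a → Square b
  Square-resp {a} {b} P∣a-b (w , P∣a-w²) =
    w , ∣-by-combination₂ (b - w * w) -1ℤ (a - b) 1ℤ (a - w * w) (rearrange a b w) P∣a-b P∣a-w²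
    where
      rearrange : ∀ a b w → b - w * w ≡ -1ℤ * (a - b) + 1ℤ * (a - w * w)
      rearrange = solve-∀

  Square-m*m : ∀ m → Square (m * m)
  Square-m*m m = m , ∣-diff-refl (m * m)

  Square-* : ∀ {x y} → Square x → Square y → Square (x * y)
  Square-* {x} {y} (w , P∣x-w²) (v , P∣y-v²) =
    w * v , ∣-by-combination₂ _ y (x - w * w) (w * w) (y - v * v) (rearrange x y w v) P∣x-w² P∣y-v²
    where
      rearrange : ∀ x y w v → x * y - w * v * (w * v) ≡ y * (x - w * w) + w * w * (y - v * v)
      rearrange = solve-∀

  P∤square-root : ∀ {x w} → ¬ P ∣ℤ x → P ∣ℤ x - w * w → ¬ P ∣ℤ w
  P∤square-root {x} {w} P∤x P∣x-w² P∣w =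
    P∤x (∣-by-combination₂ x 1ℤ (x - w * w) w w (rearrange x w) P∣x-w² P∣w)
    where
      rearrange : ∀ x w → x ≡ 1ℤ * (x - w * w) + w * w
      rearrange = solve-∀

  Square-cancel : ∀ {x y} → ¬ P ∣ℤ x → Square x → Square (x * y) → Square y
  Square-cancel {x} {y} P∤x (w , P∣x-w²) (v , P∣xy-v²) = v * w⁻¹ , P∣y-[vw⁻¹]²
    where
      w⁻¹ : ℤ
      w⁻¹ = proj₁ (inverse-mod (P∤square-root {x} {w} P∤x P∣x-w²))
      P∣ww⁻¹-1 : P ∣ℤ w * w⁻¹ - 1ℤ
      P∣ww⁻¹-1 = proj₂ (inverse-mod (P∤square-root {x} {w} P∤x P∣x-w²))
      rearrange : ∀ x y w w⁻¹ v →
        y - v * w⁻¹ * (v * w⁻¹) ≡ - y * (1ℤ + w * w⁻¹) * (w * w⁻¹ - 1ℤ) + - (w⁻¹ * w⁻¹ * y) * (x - w * w)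
                                  + w⁻¹ * w⁻¹ * (x * y - v * v)
      rearrange = solve-∀
      P∣y-[vw⁻¹]² : P ∣ℤ y - v * w⁻¹ * (v * w⁻¹)
      P∣y-[vw⁻¹]² = ∣-by-combination₃ _ (- y * (1ℤ + w * w⁻¹)) (w * w⁻¹ - 1ℤ) (- (w⁻¹ * w⁻¹ * y)) (x - w * w)
                                      (w⁻¹ * w⁻¹) (x * y - v * v) (rearrange x y w w⁻¹ v)
                                      P∣ww⁻¹-1 P∣x-w² P∣xy-v²

  P∤c*i²-c*j² : ∀ {c} i j → ¬ P ∣ℤ c → i ≢ j → i ≤ half → j ≤ half →
                ¬ P ∣ℤ c * (+ i * + i) - c * (+ j * + j)
  P∤c*i²-c*j² {c} i j P∤c i≢j i≤half j≤half P∣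
    with P∣m*n⇒P∣m⊎P∣n (∣-by-multiple _ 1ℤ (c * (+ i * + i) - c * (+ j * + j)) (factor c (+ i) (+ j)) P∣)
    where
      factor : ∀ c i j → c * ((i - j) * (i + j)) ≡ 1ℤ * (c * (i * i) - c * (j * j))
      factor = solve-∀
  ... | inj₁ P∣c = P∤c P∣c
  ... | inj₂ P∣[i-j][i+j] with P∣m*n⇒P∣m⊎P∣n P∣[i-j][i+j]
  ... | inj₁ P∣i-j = i≢j (P∣i-j⇒i≡j (i≤half⇒i<p i≤half) (i≤half⇒i<p j≤half) P∣i-j)
  ... | inj₂ P∣i+j = i≢j (trans (ℕₚ.m+n≡0⇒m≡0 i i+j≡0) (sym (ℕₚ.m+n≡0⇒n≡0 i i+j≡0)))
    where
      i+j≡0 : i ℕ.+ j ≡ 0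
      i+j≡0 = Intₚ.+-injective
                (P∣m⇒∣m∣<p⇒m≡0 (subst (P ∣ℤ_) (sym (Intₚ.pos-+ i j)) P∣i+j) (i+j<p i≤half j≤half))

  Collision : (Fin (suc half) → ℤ) → Set
  Collision f = Σ (Fin (suc half)) λ a → Σ (Fin (suc half)) λ a′ → a ≢ a′ × P ∣ℤ f a - f a′

  pigeonhole-mod₂ : (f g : Fin (suc half) → ℤ) →
                    Collision f ⊎ Collision g ⊎ Σ (Fin (suc half)) λ a → Σ (Fin (suc half)) λ b → P ∣ℤ f a - g b
  pigeonhole-mod₂ f g =
    let i , j , i<j , P∣ = pigeonhole-mod p<2[1+half] ([ f , g ]′ ∘ Fin.splitAt (suc half))
    in classify (Fin.splitAt (suc half) i) (Fin.splitAt (suc half) j) (<⇒splitAt-≢ i<j) P∣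
    where
      p<2[1+half] : p ℕ.< suc half ℕ.+ suc half
      p<2[1+half] = subst (ℕ._< suc half ℕ.+ suc half) (sym p≡1+2half)
                          (ℕ.s≤s (ℕₚ.≤-reflexive (sym (ℕₚ.+-suc half half))))
      classify : ∀ x y → x ≢ y → P ∣ℤ [ f , g ]′ x - [ f , g ]′ y →
                 Collision f ⊎ Collision g ⊎ Σ (Fin (suc half)) λ a → Σ (Fin (suc half)) λ b → P ∣ℤ f a - g b
      classify (inj₁ a) (inj₁ a′) x≢y P∣ = inj₁ (a , a′ , x≢y ∘ cong inj₁ , P∣)
      classify (inj₂ b) (inj₂ b′) x≢y P∣ = inj₂ (inj₁ (b , b′ , x≢y ∘ cong inj₂ , P∣))
      classify (inj₁ a) (inj₂ b) _ P∣ = inj₂ (inj₂ (a , b , P∣))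
      classify (inj₂ b) (inj₁ a) _ P∣ = inj₂ (inj₂ (a , b , ∣-diff-comm {a = g b} {f a} P∣))

  toℕ≤half : (a : Fin (suc half)) → toℕ a ≤ half
  toℕ≤half a = ℕ.s≤s⁻¹ (Finₚ.toℕ<n a)

  -- Pigeonhole on the p + 1 residues u a² and 1 − v b² for 0 ≤ a, b ≤ (p − 1)/2.
  u*X²+v*Y²≡1 : ∀ {u v} → ¬ P ∣ℤ u → ¬ P ∣ℤ v →
                Σ ℤ λ X → Σ ℤ λ Y → P ∣ℤ u * (X * X) + v * (Y * Y) - 1ℤ
  u*X²+v*Y²≡1 {u} {v} P∤u P∤v = conclude (pigeonhole-mod₂ (λ a → u * sq a) (λ b → 1ℤ - v * sq b))
    where
      sq : Fin (suc half) → ℤ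
      sq a = + toℕ a * + toℕ a
      flip-family : ∀ v s t → v * t - v * s ≡ 1ℤ * ((1ℤ - v * s) - (1ℤ - v * t))
      flip-family = solve-∀
      regroup : ∀ u v s t → u * s + v * t - 1ℤ ≡ 1ℤ * (u * s - (1ℤ - v * t))
      regroup = solve-∀
      conclude : Collision (λ a → u * sq a) ⊎ Collision (λ b → 1ℤ - v * sq b) ⊎
                 (Σ (Fin (suc half)) λ a → Σ (Fin (suc half)) λ b → P ∣ℤ u * sq a - (1ℤ - v * sq b)) →
                 Σ ℤ λ X → Σ ℤ λ Y → P ∣ℤ u * (X * X) + v * (Y * Y) - 1ℤ
      conclude (inj₁ (a , a′ , a≢a′ , P∣)) =
        ⊥-elim (P∤c*i²-c*j² (toℕ a) (toℕ a′) P∤u (a≢a′ ∘ Finₚ.toℕ-injective)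
                 (toℕ≤half a) (toℕ≤half a′) P∣)
      conclude (inj₂ (inj₁ (b , b′ , b≢b′ , P∣))) =
        ⊥-elim (P∤c*i²-c*j² (toℕ b′) (toℕ b) P∤v (b≢b′ ∘ sym ∘ Finₚ.toℕ-injective)
                 (toℕ≤half b′) (toℕ≤half b)
                 (∣-by-multiple _ 1ℤ ((1ℤ - v * sq b) - (1ℤ - v * sq b′)) (flip-family v (sq b) (sq b′)) P∣))
      conclude (inj₂ (inj₂ (a , b , P∣))) =
        + toℕ a , + toℕ b , ∣-by-multiple _ 1ℤ (u * sq a - (1ℤ - v * sq b)) (regroup u v (sq a) (sq b)) P∣

  Square-x*y : ∀ {x y} m → P ∣ℤ y - x * (m * m) → Square (x * y)
  Square-x*y {x} {y} m P∣ = x * m , ∣-by-multiple _ x (y - x * (m * m)) (factor x y m) P∣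
    where
      factor : ∀ x y m → x * y - x * m * (x * m) ≡ x * (y - x * (m * m))
      factor = solve-∀

  Square-x : ∀ {x} m a → ¬ P ∣ℤ m → P ∣ℤ a * a - x * (m * m) → Square x
  Square-x {x} m a P∤m P∣ =
    Square-cancel {m * m} {x} (P∤m⇒P∤n⇒P∤m*n {m} {m} P∤m P∤m) (Square-m*m m)
                  (a , ∣-by-multiple _ -1ℤ (a * a - x * (m * m)) (negate x m a) P∣)
    where
      negate : ∀ x m a → m * m * x - a * a ≡ -1ℤ * (a * a - x * (m * m))
      negate = solve-∀

  -- Pigeonhole on the p + 1 residues a² (0 ≤ a ≤ (p − 1)/2) and y, x b² (1 ≤ b ≤ (p − 1)/2).
  Square-trichotomy : ∀ {x y} → ¬ P ∣ℤ x → ¬ P ∣ℤ y → Square (x * y) ⊎ Square x ⊎ Square y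
  Square-trichotomy {x} {y} P∤x P∤y = conclude (pigeonhole-mod₂ (λ a → sq (toℕ a)) B)
    where
      sq : ℕ → ℤ
      sq m = + m * + m
      B : Fin (suc half) → ℤ
      B Fin.zero = y
      B (Fin.suc b) = x * sq (suc (toℕ b))
      P∤1+b : ∀ (b : Fin half) → ¬ P ∣ℤ + suc (toℕ b)
      P∤1+b b P∣ with () ← P∣m⇒∣m∣<p⇒m≡0 P∣ (i≤half⇒i<p (Finₚ.toℕ<n b))
      1*-both : ∀ s t → P ∣ℤ s - t → P ∣ℤ 1ℤ * s - 1ℤ * t
      1*-both s t = subst (P ∣ℤ_) (sym (cong₂ _-_ (Intₚ.*-identityˡ s) (Intₚ.*-identityˡ t)))
      conclude : Collision (λ a → sq (toℕ a)) ⊎ Collision B ⊎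
                 (Σ (Fin (suc half)) λ a → Σ (Fin (suc half)) λ b → P ∣ℤ sq (toℕ a) - B b) →
                 Square (x * y) ⊎ Square x ⊎ Square y
      conclude (inj₁ (a , a′ , a≢a′ , P∣)) =
        ⊥-elim (P∤c*i²-c*j² (toℕ a) (toℕ a′) P∤1 (a≢a′ ∘ Finₚ.toℕ-injective)
                 (toℕ≤half a) (toℕ≤half a′) (1*-both (sq (toℕ a)) (sq (toℕ a′)) P∣))
      conclude (inj₂ (inj₁ (Fin.zero , Fin.zero , 0≢0 , _))) = ⊥-elim (0≢0 refl)
      conclude (inj₂ (inj₁ (Fin.zero , Fin.suc b , _ , P∣))) = inj₁ (Square-x*y {x} {y} (+ suc (toℕ b)) P∣)
      conclude (inj₂ (inj₁ (Fin.suc b , Fin.zero , _ , P∣))) =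
        inj₁ (Square-x*y {x} {y} (+ suc (toℕ b)) (∣-diff-comm {a = x * sq (suc (toℕ b))} {y} P∣))
      conclude (inj₂ (inj₁ (Fin.suc b , Fin.suc b′ , b≢b′ , P∣))) =
        ⊥-elim (P∤c*i²-c*j² (suc (toℕ b)) (suc (toℕ b′)) P∤x
                 (b≢b′ ∘ cong Fin.suc ∘ Finₚ.toℕ-injective ∘ ℕₚ.suc-injective) (Finₚ.toℕ<n b) (Finₚ.toℕ<n b′) P∣)
      conclude (inj₂ (inj₂ (a , Fin.zero , P∣))) = inj₂ (inj₂ (+ toℕ a , ∣-diff-comm {a = sq (toℕ a)} {y} P∣))
      conclude (inj₂ (inj₂ (a , Fin.suc b , P∣))) = inj₂ (inj₁ (Square-x {x} (+ suc (toℕ b)) (+ toℕ a) (P∤1+b b) P∣))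

  Square-*⇔ : ∀ {x y} → ¬ P ∣ℤ x → ¬ P ∣ℤ y → Square (x * y) ⇔ (Square x ⇔ Square y)
  Square-*⇔ {x} {y} P∤x P∤y = mk⇔
    (λ □xy → mk⇔ (λ □x → Square-cancel {x} {y} P∤x □x □xy)
                 (λ □y → Square-cancel {y} {x} P∤y □y (subst Square (Intₚ.*-comm x y) □xy)))
    (from (Square-trichotomy P∤x P∤y))
    where
      from : Square (x * y) ⊎ Square x ⊎ Square y → Square x ⇔ Square y → Square (x * y)
      from (inj₁ □xy) _ = □xy
      from (inj₂ (inj₁ □x)) □x⇔□y = Square-* {x} {y} □x (Equivalence.to □x⇔□y □x)
      from (inj₂ (inj₂ □y)) □x⇔□y = Square-* {x} {y} (Equivalence.from □x⇔□y □y) □y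

  Square? : ∀ c → Dec (Square c)
  Square? c = map′ (λ (i , P∣) → + toℕ i , P∣) (λ (w , P∣c-w²) → residue w , P∣c-r² w P∣c-w²)
                   (Finₚ.any? (λ (i : Fin p) → P∣? (c - + toℕ i * + toℕ i)))
    where
      P∣c-r² : ∀ w → P ∣ℤ c - w * w → P ∣ℤ c - + toℕ (residue w) * + toℕ (residue w)
      P∣c-r² w P∣c-w² = ∣-by-sum _ (c - w * w) ((w + r) * (w - r)) (difference-of-squares c w r)
                                 P∣c-w² (ℤ∣.∣n⇒∣m*n (w + r) (P∣m-residue w))
        where
          r = + toℕ (residue w)
          difference-of-squares : ∀ c w r → c - r * r ≡ (c - w * w) + (w + r) * (w - r)
          difference-of-squares = solve-∀

  -- p-adic integers

  P^_ : ℕ → ℤ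
  P^ k = + (p ^ k)

  P^-suc : ∀ k → P^ suc k ≡ P * P^ k
  P^-suc k = Intₚ.pos-* p (p ^ k)

  P^-+ : ∀ a b → P^ (a ℕ.+ b) ≡ P^ a * P^ b
  P^-+ a b = trans (cong +_ (ℕₚ.^-distribˡ-+-* p a b)) (Intₚ.pos-* (p ^ a) (p ^ b))

  P^1 : P^ 1 ≡ P
  P^1 = cong +_ (ℕₚ.*-identityʳ p)

  P^-mono-∣ : ∀ {a b} → a ≤ b → P^ a ∣ℤ P^ b
  P^-mono-∣ {a} a≤b with ℕₚ.m≤n⇒∃[o]m+o≡n a≤b
  ... | o , refl = divides (P^ o) (trans (P^-+ a o) (Intₚ.*-comm (P^ a) (P^ o)))

  P∣P^suc : ∀ k → P ∣ℤ P^ suc k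
  P∣P^suc k = divides (P^ k) (trans (P^-suc k) (Intₚ.*-comm P (P^ k)))

  infix 4 _≈_

  record _≈_ (a b : ℤₚ p) : Set where
    constructor mk≈
    field
      congruent : ∀ k → P^ k ∣ℤ seq a k - seq b k

  open _≈_

  ≈-refl : ∀ {a} → a ≈ a
  ≈-refl {a} = mk≈ λ k → ∣-diff-refl (seq a k)

  ≈-sym : ∀ {a b} → a ≈ b → b ≈ a
  ≈-sym {a} {b} a≈b = mk≈ λ k → ∣-diff-comm {a = seq a k} {seq b k} (congruent a≈b k)

  Zero : ℤₚ p → Set
  Zero x = ∀ k → P^ k ∣ℤ seq x k

  seq-coh : ∀ x k → P^ k ∣ℤ seq x (suc k) - seq x k
  seq-coh x k = ℤ∣.∣ᵤ⇒∣ (coh x k)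

  seq-coh-+ : ∀ x k d → P^ k ∣ℤ seq x (d ℕ.+ k) - seq x k
  seq-coh-+ x k zero = ∣-diff-refl (seq x k)
  seq-coh-+ x k (suc d) =
    ∣-by-sum _ (seq x (suc (d ℕ.+ k)) - seq x (d ℕ.+ k)) (seq x (d ℕ.+ k) - seq x k)
             (telescope (seq x (suc (d ℕ.+ k))) (seq x (d ℕ.+ k)) (seq x k))
             (ℤ∣.∣-trans (P^-mono-∣ (ℕₚ.m≤n+m k d)) (seq-coh x (d ℕ.+ k))) (seq-coh-+ x k d)
    where
      telescope : ∀ a b c → a - c ≡ (a - b) + (b - c)
      telescope = solve-∀

  seq-coh-≤ : ∀ x {k K} → k ≤ K → P^ k ∣ℤ seq x K - seq x k
  seq-coh-≤ x {k} k≤K with ℕₚ.m≤n⇒∃[o]m+o≡n k≤K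
  ... | d , refl = subst (λ K → P^ k ∣ℤ seq x K - seq x k) (ℕₚ.+-comm d k) (seq-coh-+ x k d)

  seq-coh-1 : ∀ x k → P ∣ℤ seq x (suc k) - seq x 1
  seq-coh-1 x k = subst (_∣ℤ seq x (suc k) - seq x 1) P^1 (seq-coh-≤ x (ℕ.s≤s ℕ.z≤n))

  P∤seq₁⇒P∤seq : ∀ {u} → ¬ P ∣ℤ seq u 1 → ∀ k → ¬ P ∣ℤ seq u (suc k)
  P∤seq₁⇒P∤seq {u} P∤u₁ k P∣uₖ =
    P∤u₁ (∣-by-difference (seq u 1) (seq u (suc k)) (seq u (suc k) - seq u 1) (cancel (seq u (suc k)) (seq u 1))
                          P∣uₖ (seq-coh-1 u k))
    where
      cancel : ∀ a b → b ≡ a - (a - b)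
      cancel = solve-∀

  Zero⇒P∣seq₁ : ∀ {x} → Zero x → P ∣ℤ seq x 1
  Zero⇒P∣seq₁ {x} x≡0 = subst (_∣ℤ seq x 1) P^1 (x≡0 1)

  infixr 8 _·_
  infixl 6 _+ₚ_

  _·_ : ℤ → ℤₚ p → ℤₚ p
  c · x = record
    { seq = λ k → c * seq x k
    ; coh = λ k → ℤ∣.∣⇒∣ᵤ (∣-by-multiple _ c (seq x (suc k) - seq x k)
                                          (factor c (seq x (suc k)) (seq x k)) (seq-coh x k))
    }
    where
      factor : ∀ c a b → c * a - c * b ≡ c * (a - b)
      factor = solve-∀

  _+ₚ_ : ℤₚ p → ℤₚ p → ℤₚ p
  x +ₚ y = record
    { seq = λ k → seq x k + seq y k
    ; coh = λ k → ℤ∣.∣⇒∣ᵤ (∣-by-sum _ (seq x (suc k) - seq x k) (seq y (suc k) - seq y k)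
                                     (regroup (seq x (suc k)) (seq y (suc k)) (seq x k) (seq y k))
                                     (seq-coh x k) (seq-coh y k))
    }
    where
      regroup : ∀ a b c d → (a + b) - (c + d) ≡ (a - c) + (b - d)
      regroup = solve-∀

  IsUnit⇒P∤seq₁ : ∀ {u : ℤₚ p} → IsUnit u → ¬ P ∣ℤ seq u 1
  IsUnit⇒P∤seq₁ {u} (v , uv≡1) P∣u₁ =
    P∤1 (∣-by-difference 1ℤ (seq u 1 * seq v 1) (seq u 1 * seq v 1 - 1ℤ) (cancel (seq u 1 * seq v 1))
                         (ℤ∣.∣m⇒∣m*n (seq v 1) P∣u₁)
                         (subst (_∣ℤ seq u 1 * seq v 1 - 1ℤ) P^1
                                (ℤ∣.∣ᵤ⇒∣ {P^ 1} {seq u 1 * seq v 1 - 1ℤ} (uv≡1 1))))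
    where
      cancel : ∀ a → 1ℤ ≡ a - (a - 1ℤ)
      cancel = solve-∀

  Zero-P· : ∀ {x} → Zero (P · x) → Zero x
  Zero-P· {x} Px≡0 k =
    ∣-by-difference _ (seq x (suc k)) (seq x (suc k) - seq x k) (cancel (seq x k) (seq x (suc k)))
      (ℤ∣.*-cancelˡ-∣ P (subst (_∣ℤ P * seq x (suc k)) (P^-suc k) (Px≡0 (suc k)))) (seq-coh x k)
    where
      cancel : ∀ a b → a ≡ b - (b - a)
      cancel = solve-∀

  -- Newton's correction t = d (2 U s)⁻¹, where c − U s² = d p^(k+1) at level k + 2.
  newton-step : ∀ (U c : ℤₚ p) k s g⁻¹ →
    P^ suc k ∣ℤ seq U (suc k) * (s * s) - seq c (suc k) → P ∣ℤ + 2 * seq U (suc (suc k)) * s * g⁻¹ - 1ℤ →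
    Σ ℤ λ t → P^ suc (suc k) ∣ℤ seq U (suc (suc k)) * ((s + t * P^ suc k) * (s + t * P^ suc k)) - seq c (suc (suc k))
  newton-step U c k s g⁻¹ q∣U₁s²-c₁ P∣gg⁻¹-1 = d * g⁻¹ , P^2+k∣
    where
      U₁ U₂ c₁ c₂ q : ℤ
      U₁ = seq U (suc k)
      U₂ = seq U (suc (suc k))
      c₁ = seq c (suc k)
      c₂ = seq c (suc (suc k))
      q = P^ suc k
      split : ∀ c₂ c₁ U₂ U₁ t →
              c₂ - U₂ * t ≡ 1ℤ * (c₂ - c₁) + (- t) * (U₂ - U₁) + -1ℤ * (U₁ * t - c₁)
      split = solve-∀
      q∣c₂-U₂s² : q ∣ℤ c₂ - U₂ * (s * s)
      q∣c₂-U₂s² = ∣-by-combination₃ _ 1ℤ (c₂ - c₁) (- (s * s)) (U₂ - U₁) -1ℤ (U₁ * (s * s) - c₁)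
                    (split c₂ c₁ U₂ U₁ (s * s)) (seq-coh c (suc k)) (seq-coh U (suc k)) q∣U₁s²-c₁
      d : ℤ
      d = ℤ∣.quotient q∣c₂-U₂s²
      expand : ∀ U₂ s d g⁻¹ q c₂ →
        U₂ * ((s + d * g⁻¹ * q) * (s + d * g⁻¹ * q)) - c₂
          ≡ -1ℤ * ((c₂ - U₂ * (s * s)) - d * q) + 1ℤ * (q * (d * (+ 2 * U₂ * s * g⁻¹ - 1ℤ)))
            + U₂ * (d * g⁻¹) * (d * g⁻¹) * (q * q)
      expand = solve-∀
      Pq∣c₂-U₂s²-dq : P * q ∣ℤ (c₂ - U₂ * (s * s)) - d * q
      Pq∣c₂-U₂s²-dq = divides 0ℤ (trans (cong (_- d * q) (ℤ∣._∣_.equality q∣c₂-U₂s²)) (Intₚ.+-inverseʳ (d * q)))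
      Pq∣q[gg⁻¹-1]d : P * q ∣ℤ q * (d * (+ 2 * U₂ * s * g⁻¹ - 1ℤ))
      Pq∣q[gg⁻¹-1]d = subst (_∣ℤ q * (d * (+ 2 * U₂ * s * g⁻¹ - 1ℤ))) (Intₚ.*-comm q P)
                            (*-pres-∣ {q} {P} ℤ∣.∣-refl (ℤ∣.∣n⇒∣m*n d P∣gg⁻¹-1))
      Pq∣q² : P * q ∣ℤ q * q
      Pq∣q² = *-pres-∣ (P∣P^suc k) ℤ∣.∣-refl
      P^2+k∣ : P^ suc (suc k) ∣ℤ U₂ * ((s + d * g⁻¹ * q) * (s + d * g⁻¹ * q)) - c₂
      P^2+k∣ = subst (_∣ℤ U₂ * ((s + d * g⁻¹ * q) * (s + d * g⁻¹ * q)) - c₂) (sym (P^-suc (suc k)))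
                     (∣-by-combination₃ _ -1ℤ ((c₂ - U₂ * (s * s)) - d * q) 1ℤ (q * (d * (+ 2 * U₂ * s * g⁻¹ - 1ℤ)))
                                          (U₂ * (d * g⁻¹) * (d * g⁻¹)) (q * q) (expand U₂ s d g⁻¹ q c₂)
                                          Pq∣c₂-U₂s²-dq Pq∣q[gg⁻¹-1]d Pq∣q²)

  hensel : ∀ (U c : ℤₚ p) (w : ℤ) → ¬ P ∣ℤ seq U 1 → ¬ P ∣ℤ w → P ∣ℤ seq U 1 * (w * w) - seq c 1 →
           Σ (ℤₚ p) λ s → (∀ k → P^ k ∣ℤ seq U k * (seq s k * seq s k) - seq c k) × P ∣ℤ seq s 1 - w
  hensel U c w P∤U₁ P∤w P∣U₁w²-c₁ = root , root-solves , root≡w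
    where
      Approx : ℕ → ℤ → Set
      Approx k s = P^ suc k ∣ℤ seq U (suc k) * (s * s) - seq c (suc k) × P ∣ℤ s - w

      P∤2Us : ∀ k s → P ∣ℤ s - w → ¬ P ∣ℤ + 2 * seq U (suc (suc k)) * s
      P∤2Us k s P∣s-w =
        P∤m⇒P∤n⇒P∤m*n {+ 2 * seq U (suc (suc k))} {s}
          (P∤m⇒P∤n⇒P∤m*n {+ 2} {seq U (suc (suc k))} P∤2 (P∤seq₁⇒P∤seq {U} P∤U₁ (suc k)))
          (λ P∣s → P∤w (∣-by-difference w s (s - w) (cancel s w) P∣s P∣s-w))
        where
          cancel : ∀ s w → w ≡ s - (s - w)
          cancel = solve-∀

      lift : ∀ k s → Approx k s → Σ ℤ λ s′ → Approx (suc k) s′ × P^ suc k ∣ℤ s′ - s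
      lift k s (q∣U₁s²-c₁ , P∣s-w) = s + t * P^ suc k , (P^2+k∣ , P∣s′-w) , divides t (cancel s t (P^ suc k))
        where
          step = newton-step U c k s (proj₁ (inverse-mod (P∤2Us k s P∣s-w))) q∣U₁s²-c₁
                             (proj₂ (inverse-mod (P∤2Us k s P∣s-w)))
          t = proj₁ step
          P^2+k∣ = proj₂ step
          shift : ∀ s w t q → s + t * q - w ≡ (s - w) + t * q
          shift = solve-∀
          P∣s′-w : P ∣ℤ s + t * P^ suc k - w
          P∣s′-w = ∣-by-sum _ (s - w) (t * P^ suc k) (shift s w t (P^ suc k)) P∣s-w (ℤ∣.∣n⇒∣m*n t (P∣P^suc k))
          cancel : ∀ s t q → s + t * q - s ≡ t * q
          cancel = solve-∀

      approx : ∀ k → Σ ℤ (Approx k)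
      approx zero = w , subst (_∣ℤ seq U 1 * (w * w) - seq c 1) (sym P^1) P∣U₁w²-c₁ , ∣-diff-refl w
      approx (suc k) = proj₁ next , proj₁ (proj₂ next)
        where
          next = lift k (proj₁ (approx k)) (proj₂ (approx k))

      root : ℤₚ p
      root = record { seq = r ; coh = ℤ∣.∣⇒∣ᵤ ∘ r-coh }
        where
          r : ℕ → ℤ
          r zero = w
          r (suc k) = proj₁ (approx k)
          r-coh : ∀ k → P^ k ∣ℤ r (suc k) - r k
          r-coh zero = 1∣ (r 1 - r 0)
          r-coh (suc k) = proj₂ (proj₂ (lift k (proj₁ (approx k)) (proj₂ (approx k))))

      root-solves : ∀ k → P^ k ∣ℤ seq U k * (seq root k * seq root k) - seq c k
      root-solves zero = 1∣ _
      root-solves (suc k) = proj₁ (proj₂ (approx k))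

      root≡w : P ∣ℤ seq root 1 - w
      root≡w = proj₂ (proj₂ (approx 0))

  P^K∣P^e*P^e*E⇒P²∣E : ∀ {e K E} → (e ℕ.+ e) ℕ.+ 2 ≤ K → P^ K ∣ℤ P^ e * P^ e * E → P * P ∣ℤ E
  P^K∣P^e*P^e*E⇒P²∣E {e} {K} {E} 2e+2≤K P^K∣ =
    ℤ∣.*-cancelˡ-∣ (P^ (e ℕ.+ e)) {{ℕₚ.m^n≢0 p (e ℕ.+ e)}}
      (subst₂ _∣ℤ_ (trans (P^-+ (e ℕ.+ e) 2) (cong (P^ (e ℕ.+ e) *_) (trans (P^-suc 1) (cong (P *_) P^1))))
                   (cong (_* E) (sym (P^-+ e e)))
                   (ℤ∣.∣-trans (P^-mono-∣ 2e+2≤K) P^K∣))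

  Zero-from-diagonal : ∀ w → (∀ k → P^ k ∣ℤ seq w (k ℕ.+ k)) → Zero w
  Zero-from-diagonal w P^k∣w₂ₖ k =
    ∣-by-difference (seq w k) (seq w (k ℕ.+ k)) (seq w (k ℕ.+ k) - seq w k)
                    (cancel (seq w (k ℕ.+ k)) (seq w k)) (P^k∣w₂ₖ k) (seq-coh-≤ w (ℕₚ.m≤m+n k k))
    where
      cancel : ∀ a b → b ≡ a - (a - b)
      cancel = solve-∀

  -- By induction on e, p^e divides the K-th coordinates whenever 2e ≤ K.
  descent : ∀ (α β : ℕ → ℤ) (x y z : ℤₚ p) →
    (∀ k → P^ k ∣ℤ α k * (seq x k * seq x k) + β k * (seq y k * seq y k) - seq z k * seq z k) →
    (∀ K → 1 ≤ K → ∀ X Y Z → P * P ∣ℤ α K * (X * X) + β K * (Y * Y) - Z * Z →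
                             P ∣ℤ X × P ∣ℤ Y × P ∣ℤ Z) →
    Zero x × Zero y × Zero z
  descent α β x y z solves P²∣⇒P∣ =
    Zero-from-diagonal x (proj₁ ∘ deep) , Zero-from-diagonal y (proj₁ ∘ proj₂ ∘ deep) ,
    Zero-from-diagonal z (proj₂ ∘ proj₂ ∘ deep)
    where
      DividesAll : ℕ → ℕ → Set
      DividesAll e K = P^ e ∣ℤ seq x K × P^ e ∣ℤ seq y K × P^ e ∣ℤ seq z K

      deep-at : ∀ e K → e ℕ.+ e ≤ K → DividesAll e K
      deep-at zero K _ = 1∣ _ , 1∣ _ , 1∣ _
      deep-at (suc e) K 2[1+e]≤K = step (deep-at e K 2e≤K)
        where
          2e+2≤K : (e ℕ.+ e) ℕ.+ 2 ≤ K
          2e+2≤K = subst (_≤ K) (trans (cong suc (ℕₚ.+-suc e e)) (ℕₚ.+-comm 2 (e ℕ.+ e))) 2[1+e]≤K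
          2e≤K : e ℕ.+ e ≤ K
          2e≤K = ℕₚ.≤-trans (ℕₚ.m≤m+n (e ℕ.+ e) 2) 2e+2≤K
          lift : ∀ {W w} → P ∣ℤ W → w ≡ W * P^ e → P^ suc e ∣ℤ w
          lift {W} P∣W refl = subst (_∣ℤ W * P^ e) (sym (P^-suc e)) (*-pres-∣ P∣W ℤ∣.∣-refl)
          step : DividesAll e K → DividesAll (suc e) K
          step (divides X x≡XPᵉ , divides Y y≡YPᵉ , divides Z z≡ZPᵉ) =
            let P²∣E = P^K∣P^e*P^e*E⇒P²∣E {e} 2e+2≤K
                         (subst (P^ K ∣ℤ_) (quadratic-form-scale {α K} {β K} {X = X} {Y} {Z} {P^ e} x≡XPᵉ y≡YPᵉ z≡ZPᵉ)
                                (solves K))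
                P∣X , P∣Y , P∣Z = P²∣⇒P∣ K (ℕₚ.≤-trans (ℕ.s≤s ℕ.z≤n) 2[1+e]≤K) X Y Z P²∣E
            in lift P∣X x≡XPᵉ , lift P∣Y y≡YPᵉ , lift P∣Z z≡ZPᵉ

      deep : ∀ k → DividesAll k (k ℕ.+ k)
      deep k = deep-at k (k ℕ.+ k) ℕₚ.≤-refl

  -- Solvability of z² = a x² + b y² over ℤₚ

  Solution : (a b x y z : ℤₚ p) → Set
  Solution a b x y z =
    ∀ k → P^ k ∣ℤ seq a k * (seq x k * seq x k) + seq b k * (seq y k * seq y k) - seq z k * seq z k

  record Solvable (a b : ℤₚ p) : Set where
    constructor solvable
    field
      x y z : ℤₚ p
      nontrivial : ¬ (Zero x × Zero y × Zero z)
      solution : Solution a b x y z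

  HilbertSolvable⇔Solvable : ∀ {a b} → HilbertSolvable a b ⇔ Solvable a b
  HilbertSolvable⇔Solvable = mk⇔
    (λ (x , y , z , nontrivial , solves) →
       solvable x y z (λ (x≡0 , y≡0 , z≡0) → nontrivial (ℤ∣.∣⇒∣ᵤ ∘ x≡0 , ℤ∣.∣⇒∣ᵤ ∘ y≡0 , ℤ∣.∣⇒∣ᵤ ∘ z≡0))
                      (ℤ∣.∣ᵤ⇒∣ ∘ solves))
    (λ (solvable x y z nontrivial solves) →
       x , y , z , (λ (x≡0 , y≡0 , z≡0) → nontrivial (ℤ∣.∣ᵤ⇒∣ ∘ x≡0 , ℤ∣.∣ᵤ⇒∣ ∘ y≡0 , ℤ∣.∣ᵤ⇒∣ ∘ z≡0))
                 , ℤ∣.∣⇒∣ᵤ ∘ solves)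

  Solvable-resp-≈ : ∀ {a a′ b b′} → a ≈ a′ → b ≈ b′ → Solvable a b → Solvable a′ b′
  Solvable-resp-≈ {a} {a′} {b} {b′} a≈a′ b≈b′ (solvable x y z nontrivial solves) = solvable x y z nontrivial λ k →
    ∣-by-combination₃ _ 1ℤ _ (- (seq x k * seq x k)) (seq a k - seq a′ k) (- (seq y k * seq y k)) (seq b k - seq b′ k)
      (perturb (seq a k) (seq a′ k) (seq b k) (seq b′ k) (seq x k * seq x k) (seq y k * seq y k) (seq z k * seq z k))
      (solves k) (congruent a≈a′ k) (congruent b≈b′ k)
    where
      perturb : ∀ a a′ b b′ s t r →
                a′ * s + b′ * t - r ≡ 1ℤ * (a * s + b * t - r) + (- s) * (a - a′) + (- t) * (b - b′)
      perturb = solve-∀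

  Solvable-resp-≈⇔ : ∀ {a a′ b b′} → a ≈ a′ → b ≈ b′ → Solvable a b ⇔ Solvable a′ b′
  Solvable-resp-≈⇔ {a} {a′} {b} {b′} a≈a′ b≈b′ =
    mk⇔ (Solvable-resp-≈ a≈a′ b≈b′) (Solvable-resp-≈ (≈-sym {a} {a′} a≈a′) (≈-sym {b} {b′} b≈b′))

  Solvable-comm : ∀ {a b} → Solvable a b → Solvable b a
  Solvable-comm {a} {b} (solvable x y z nontrivial solves) =
    solvable y x z (λ (y≡0 , x≡0 , z≡0) → nontrivial (x≡0 , y≡0 , z≡0)) λ k →
    subst (P^ k ∣ℤ_) (swap (seq a k) (seq b k) (seq x k * seq x k) (seq y k * seq y k) (seq z k * seq z k)) (solves k)
    where
      swap : ∀ a b s t r → a * s + b * t - r ≡ b * t + a * s - r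
      swap = solve-∀

  Solvable-comm⇔ : ∀ {a b} → Solvable a b ⇔ Solvable b a
  Solvable-comm⇔ = mk⇔ Solvable-comm Solvable-comm

  P^2+l≡P*[P*P^l] : ∀ l → P^ suc (suc l) ≡ P * (P * P^ l)
  P^2+l≡P*[P*P^l] l = trans (P^-suc (suc l)) (cong (P *_) (P^-suc l))

  -- Rescaling x by p, resp. y and z by p, moves a factor p² between a and the solution.
  Solvable-P²·ˡ : ∀ l u b → Solvable (P^ suc (suc l) · u) b ⇔ Solvable (P^ l · u) b
  Solvable-P²·ˡ l u b = mk⇔
    (λ (solvable x y z nontrivial solves) →
       solvable (P · x) y z (λ (Px≡0 , y≡0 , z≡0) → nontrivial (Zero-P· {x} Px≡0 , y≡0 , z≡0)) λ k →
         subst (P^ k ∣ℤ_)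
               (sym (trans (absorb P (P^ l) (seq u k) (seq x k) (seq b k * (seq y k * seq y k)) (seq z k * seq z k))
                           (cong (λ c → c * seq u k * (seq x k * seq x k) + seq b k * (seq y k * seq y k) - seq z k * seq z k)
                                 (sym (P^2+l≡P*[P*P^l] l)))))
               (solves k))
    (λ (solvable x y z nontrivial solves) →
       solvable x (P · y) (P · z) (λ (x≡0 , Py≡0 , Pz≡0) → nontrivial (x≡0 , Zero-P· {y} Py≡0 , Zero-P· {z} Pz≡0))
       λ k →
         subst (P^ k ∣ℤ_)
               (sym (trans (cong (λ c → c * seq u k * (seq x k * seq x k) + seq b k * (P * seq y k * (P * seq y k))
                                          - P * seq z k * (P * seq z k))
                                 (P^2+l≡P*[P*P^l] l))
                           (scale P (P^ l) (seq u k) (seq x k) (seq b k) (seq y k) (seq z k))))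
               (ℤ∣.∣n⇒∣m*n (P * P) (solves k)))
    where
      absorb : ∀ P q u x B r → q * u * (P * x * (P * x)) + B - r ≡ P * (P * q) * u * (x * x) + B - r
      absorb = solve-∀
      scale : ∀ P q u x b y z →
        P * (P * q) * u * (x * x) + b * (P * y * (P * y)) - P * z * (P * z) ≡ P * P * (q * u * (x * x) + b * (y * y) - z * z)
      scale = solve-∀

  P^bit_·_ : Bool → ℤₚ p → ℤₚ p
  P^bit false · u = u
  P^bit true · u = P · u

  P^0·≈ : ∀ u → P^ 0 · u ≈ u
  P^0·≈ u = mk≈ λ k →
    subst (λ a → P^ k ∣ℤ a - seq u k) (sym (Intₚ.*-identityˡ (seq u k))) (∣-diff-refl (seq u k))

  P^1·≈ : ∀ u → P^ 1 · u ≈ P · u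
  P^1·≈ u = mk≈ λ k → subst (λ c → P^ k ∣ℤ c * seq u k - P * seq u k) (sym P^1) (∣-diff-refl (P * seq u k))

  Solvable-parityˡ : ∀ l u b → Solvable (P^ l · u) b ⇔ Solvable (P^bit (isOdd l) · u) b
  Solvable-parityˡ zero u b = Solvable-resp-≈⇔ (P^0·≈ u) (≈-refl {b})
  Solvable-parityˡ (suc zero) u b = Solvable-resp-≈⇔ (P^1·≈ u) (≈-refl {b})
  Solvable-parityˡ (suc (suc l)) u b =
    subst (λ o → Solvable (P^ suc (suc l) · u) b ⇔ Solvable (P^bit o · u) b) (sym (Boolₚ.not-involutive (isOdd l)))
          (Solvable-parityˡ l u b ⇔-∘ Solvable-P²·ˡ l u b)

  Solvable-parity : ∀ la lb u v →
                    Solvable (P^ la · u) (P^ lb · v) ⇔ Solvable (P^bit (isOdd la) · u) (P^bit (isOdd lb) · v)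
  Solvable-parity la lb u v = begin
    Solvable (P^ la · u) (P^ lb · v)                          ≈⟨ Solvable-parityˡ la u (P^ lb · v) ⟩
    Solvable (P^bit (isOdd la) · u) (P^ lb · v)               ≈⟨ Solvable-comm⇔ ⟩
    Solvable (P^ lb · v) (P^bit (isOdd la) · u)               ≈⟨ Solvable-parityˡ lb v (P^bit (isOdd la) · u) ⟩
    Solvable (P^bit (isOdd lb) · v) (P^bit (isOdd la) · u)    ≈⟨ Solvable-comm⇔ ⟩
    Solvable (P^bit (isOdd la) · u) (P^bit (isOdd lb) · v)    ∎
    where open ⇔-Reasoning

  P∣a-b⇒P∤b⇒P∤a : ∀ {a b} → P ∣ℤ a - b → ¬ P ∣ℤ b → ¬ P ∣ℤ a
  P∣a-b⇒P∤b⇒P∤a {a} {b} P∣a-b P∤b P∣a = P∤b (∣-by-difference b a (a - b) (cancel a b) P∣a P∣a-b)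
    where
      cancel : ∀ a b → b ≡ a - (a - b)
      cancel = solve-∀

  P∤seq₁⇒¬Zero : ∀ {s} → ¬ P ∣ℤ seq s 1 → ¬ Zero s
  P∤seq₁⇒¬Zero {s} P∤s₁ s≡0 = P∤s₁ (Zero⇒P∣seq₁ {s} s≡0)

  solvable-units : ∀ {u v} → ¬ P ∣ℤ seq u 1 → ¬ P ∣ℤ seq v 1 → Solvable u v
  solvable-units {u} {v} P∤u₁ P∤v₁ =
    solvable (ι p X) (ι p Y) s (λ (_ , _ , s≡0) → P∤seq₁⇒¬Zero {s} (P∣a-b⇒P∤b⇒P∤a s₁≡1 P∤1) s≡0)
             λ k → ∣-by-multiple _ -1ℤ _ (negate X Y (seq u k) (seq v k) (seq s k)) (s²≡c k)
    where
      X Y : ℤ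
      X = proj₁ (u*X²+v*Y²≡1 P∤u₁ P∤v₁)
      Y = proj₁ (proj₂ (u*X²+v*Y²≡1 P∤u₁ P∤v₁))
      c : ℤₚ p
      c = (X * X) · u +ₚ (Y * Y) · v
      negate₁ : ∀ X Y u v → 1ℤ * (1ℤ * 1ℤ) - (X * X * u + Y * Y * v) ≡ -1ℤ * (u * (X * X) + v * (Y * Y) - 1ℤ)
      negate₁ = solve-∀
      negate : ∀ X Y u v s → u * (X * X) + v * (Y * Y) - s * s ≡ -1ℤ * (1ℤ * (s * s) - (X * X * u + Y * Y * v))
      negate = solve-∀
      root = hensel (ι p 1ℤ) c 1ℤ P∤1 P∤1
               (∣-by-multiple _ -1ℤ _ (negate₁ X Y (seq u 1) (seq v 1))
                              (proj₂ (proj₂ (u*X²+v*Y²≡1 P∤u₁ P∤v₁))))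
      s : ℤₚ p
      s = proj₁ root
      s²≡c : ∀ k → P^ k ∣ℤ 1ℤ * (seq s k * seq s k) - seq c k
      s²≡c = proj₁ (proj₂ root)
      s₁≡1 : P ∣ℤ seq s 1 - 1ℤ
      s₁≡1 = proj₂ (proj₂ root)

  solvable-Pu-v : ∀ {u v} → ¬ P ∣ℤ seq v 1 → Square (seq v 1) → Solvable (P · u) v
  solvable-Pu-v {u} {v} P∤v₁ (W , P∣v₁-W²) =
    solvable (ι p 0ℤ) (ι p 1ℤ) s (λ (_ , _ , s≡0) → P∤seq₁⇒¬Zero {s} (P∣a-b⇒P∤b⇒P∤a s₁≡W P∤W) s≡0)
             λ k → ∣-by-multiple _ -1ℤ _ (negate P (seq u k) (seq v k) (seq s k)) (s²≡v k)
    where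
      P∤W : ¬ P ∣ℤ W
      P∤W = P∤square-root {seq v 1} {W} P∤v₁ P∣v₁-W²
      negate : ∀ P u v s → P * u * (0ℤ * 0ℤ) + v * (1ℤ * 1ℤ) - s * s ≡ -1ℤ * (1ℤ * (s * s) - v)
      negate = solve-∀
      root = hensel (ι p 1ℤ) v W P∤1 P∤W
               (subst (λ a → P ∣ℤ a - seq v 1) (sym (Intₚ.*-identityˡ (W * W)))
                      (∣-diff-comm {a = seq v 1} {W * W} P∣v₁-W²))
      s : ℤₚ p
      s = proj₁ root
      s²≡v : ∀ k → P^ k ∣ℤ 1ℤ * (seq s k * seq s k) - seq v k
      s²≡v = proj₁ (proj₂ root)
      s₁≡W : P ∣ℤ seq s 1 - W
      s₁≡W = proj₂ (proj₂ root)

  solvable-Pu-Pv : ∀ {u v} → ¬ P ∣ℤ seq u 1 → ¬ P ∣ℤ seq v 1 → Square (-1ℤ * seq u 1 * seq v 1) →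
                   Solvable (P · u) (P · v)
  solvable-Pu-Pv {u} {v} P∤u₁ P∤v₁ (W , P∣-u₁v₁-W²) =
    solvable s (ι p 1ℤ) (ι p 0ℤ) (λ (_ , 1≡0 , _) → P∤seq₁⇒¬Zero {ι p 1ℤ} P∤1 1≡0)
             λ k → ∣-by-multiple _ P _ (factor P (seq u k) (seq v k) (seq s k)) (us²≡-v k)
    where
      u₁⁻¹ : ℤ
      u₁⁻¹ = proj₁ (inverse-mod P∤u₁)
      P∣u₁u₁⁻¹-1 : P ∣ℤ seq u 1 * u₁⁻¹ - 1ℤ
      P∣u₁u₁⁻¹-1 = proj₂ (inverse-mod P∤u₁)
      P∤W : ¬ P ∣ℤ W
      P∤W = P∤square-root { -1ℤ * seq u 1 * seq v 1} {W}
              (P∤m⇒P∤n⇒P∤m*n { -1ℤ * seq u 1} {seq v 1} (P∤m⇒P∤n⇒P∤m*n { -1ℤ} {seq u 1} P∤-1 P∤u₁) P∤v₁)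
              P∣-u₁v₁-W²
      P∤u₁⁻¹ : ¬ P ∣ℤ u₁⁻¹
      P∤u₁⁻¹ P∣u₁⁻¹ = P∤1 (∣-by-difference 1ℤ (seq u 1 * u₁⁻¹) (seq u 1 * u₁⁻¹ - 1ℤ)
                                            (cancel (seq u 1 * u₁⁻¹)) (ℤ∣.∣n⇒∣m*n (seq u 1) P∣u₁⁻¹) P∣u₁u₁⁻¹-1)
        where
          cancel : ∀ a → 1ℤ ≡ a - (a - 1ℤ)
          cancel = solve-∀
      rearrange : ∀ u v W t → u * (W * t * (W * t)) - -1ℤ * v
                    ≡ - (u * (t * t)) * (-1ℤ * u * v - W * W) + - (v * (u * t + 1ℤ)) * (u * t - 1ℤ)
      rearrange = solve-∀
      factor : ∀ P u v s → P * u * (s * s) + P * v * (1ℤ * 1ℤ) - 0ℤ * 0ℤ ≡ P * (u * (s * s) - -1ℤ * v)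
      factor = solve-∀
      root = hensel u (-1ℤ · v) (W * u₁⁻¹) P∤u₁ (P∤m⇒P∤n⇒P∤m*n {W} {u₁⁻¹} P∤W P∤u₁⁻¹)
               (∣-by-combination₂ _ (- (seq u 1 * (u₁⁻¹ * u₁⁻¹))) (-1ℤ * seq u 1 * seq v 1 - W * W)
                                    (- (seq v 1 * (seq u 1 * u₁⁻¹ + 1ℤ))) (seq u 1 * u₁⁻¹ - 1ℤ)
                                    (rearrange (seq u 1) (seq v 1) W u₁⁻¹) P∣-u₁v₁-W² P∣u₁u₁⁻¹-1)
      s : ℤₚ p
      s = proj₁ root
      us²≡-v : ∀ k → P^ k ∣ℤ seq u k * (seq s k * seq s k) - -1ℤ * seq v k
      us²≡-v = proj₁ (proj₂ root)

  P∣P*P : P ∣ℤ P * P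
  P∣P*P = ℤ∣.∣m⇒∣m*n P ℤ∣.∣-refl

  P²∣PAX²+BY²-Z²⇒P∣XYZ : ∀ A B X Y Z → ¬ P ∣ℤ A → ¬ Square B →
    P * P ∣ℤ P * A * (X * X) + B * (Y * Y) - Z * Z → P ∣ℤ X × P ∣ℤ Y × P ∣ℤ Z
  P²∣PAX²+BY²-Z²⇒P∣XYZ A B X Y Z P∤A ¬□B P²∣E = by-cases (P∣? Y)
    where
      E : ℤ
      E = P * A * (X * X) + B * (Y * Y) - Z * Z
      drop-PAX² : ∀ P A X B Y Z → B * (Y * Y) - Z * Z ≡ (P * A * (X * X) + B * (Y * Y) - Z * Z) - P * (A * (X * X))
      drop-PAX² = solve-∀
      P∣BY²-Z² : P ∣ℤ B * (Y * Y) - Z * Z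
      P∣BY²-Z² = ∣-by-difference _ E (P * (A * (X * X))) (drop-PAX² P A X B Y Z) (ℤ∣.∣-trans P∣P*P P²∣E)
                                 (ℤ∣.∣m⇒∣m*n (A * (X * X)) ℤ∣.∣-refl)
      by-cases : Dec (P ∣ℤ Y) → P ∣ℤ X × P ∣ℤ Y × P ∣ℤ Z
      by-cases (no P∤Y) =
        ⊥-elim (¬□B (Z * Y⁻¹ , ∣-by-combination₂ _ (- (B * (Y * Y⁻¹ + 1ℤ))) (Y * Y⁻¹ - 1ℤ)
                                                   (Y⁻¹ * Y⁻¹) (B * (Y * Y) - Z * Z) (rearrange B Y Y⁻¹ Z)
                                                   P∣YY⁻¹-1 P∣BY²-Z²))
        where
          Y⁻¹ : ℤ
          Y⁻¹ = proj₁ (inverse-mod P∤Y)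
          P∣YY⁻¹-1 : P ∣ℤ Y * Y⁻¹ - 1ℤ
          P∣YY⁻¹-1 = proj₂ (inverse-mod P∤Y)
          rearrange : ∀ B Y Y⁻¹ Z → B - Z * Y⁻¹ * (Z * Y⁻¹)
                        ≡ - (B * (Y * Y⁻¹ + 1ℤ)) * (Y * Y⁻¹ - 1ℤ) + Y⁻¹ * Y⁻¹ * (B * (Y * Y) - Z * Z)
          rearrange = solve-∀
      by-cases (yes P∣Y) = [ ⊥-elim ∘ P∤A , P∣m*m⇒P∣m ]′ (P∣m*n⇒P∣m⊎P∣n {A} {X * X} P∣AX²) , P∣Y , P∣Z
        where
          isolate-Z² : ∀ B Y Z → Z * Z ≡ B * (Y * Y) - (B * (Y * Y) - Z * Z)
          isolate-Z² = solve-∀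
          P∣Z : P ∣ℤ Z
          P∣Z = P∣m*m⇒P∣m (∣-by-difference _ (B * (Y * Y)) (B * (Y * Y) - Z * Z) (isolate-Z² B Y Z)
                                            (ℤ∣.∣n⇒∣m*n B (ℤ∣.∣n⇒∣m*n Y P∣Y)) P∣BY²-Z²)
          isolate-PAX² : ∀ P A X B Y Z →
            P * (A * (X * X)) ≡ 1ℤ * (P * A * (X * X) + B * (Y * Y) - Z * Z) + (- B) * (Y * Y) + 1ℤ * (Z * Z)
          isolate-PAX² = solve-∀
          P∣AX² : P ∣ℤ A * (X * X)
          P∣AX² = ℤ∣.*-cancelˡ-∣ P (∣-by-combination₃ _ 1ℤ E (- B) (Y * Y) 1ℤ (Z * Z) (isolate-PAX² P A X B Y Z)
                                                        P²∣E (*-pres-∣ P∣Y P∣Y) (*-pres-∣ P∣Z P∣Z))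

  P²∣PAX²+PBY²-Z²⇒P∣XYZ : ∀ A B X Y Z → ¬ P ∣ℤ A → ¬ Square (-1ℤ * A * B) →
    P * P ∣ℤ P * A * (X * X) + P * B * (Y * Y) - Z * Z → P ∣ℤ X × P ∣ℤ Y × P ∣ℤ Z
  P²∣PAX²+PBY²-Z²⇒P∣XYZ A B X Y Z P∤A ¬□-AB P²∣E = by-cases (P∣? Y)
    where
      E F : ℤ
      E = P * A * (X * X) + P * B * (Y * Y) - Z * Z
      F = A * (X * X) + B * (Y * Y)
      isolate-Z² : ∀ P A X B Y Z → Z * Z ≡ P * (A * (X * X) + B * (Y * Y)) - (P * A * (X * X) + P * B * (Y * Y) - Z * Z)
      isolate-Z² = solve-∀
      P∣Z : P ∣ℤ Z
      P∣Z = P∣m*m⇒P∣m (∣-by-difference _ (P * F) E (isolate-Z² P A X B Y Z)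
                                        (ℤ∣.∣m⇒∣m*n F ℤ∣.∣-refl) (ℤ∣.∣-trans P∣P*P P²∣E))
      isolate-PF : ∀ P A X B Y Z → P * (A * (X * X) + B * (Y * Y)) ≡ (P * A * (X * X) + P * B * (Y * Y) - Z * Z) + Z * Z
      isolate-PF = solve-∀
      P∣F : P ∣ℤ F
      P∣F = ℤ∣.*-cancelˡ-∣ P (∣-by-sum _ E (Z * Z) (isolate-PF P A X B Y Z) P²∣E (*-pres-∣ P∣Z P∣Z))
      by-cases : Dec (P ∣ℤ Y) → P ∣ℤ X × P ∣ℤ Y × P ∣ℤ Z
      by-cases (no P∤Y) =
        ⊥-elim (¬□-AB (A * X * Y⁻¹ , ∣-by-combination₂ _ (A * B * (Y * Y⁻¹ + 1ℤ)) (Y * Y⁻¹ - 1ℤ)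
                                                         (- (A * (Y⁻¹ * Y⁻¹))) F (rearrange A X B Y Y⁻¹)
                                                         P∣YY⁻¹-1 P∣F))
        where
          Y⁻¹ : ℤ
          Y⁻¹ = proj₁ (inverse-mod P∤Y)
          P∣YY⁻¹-1 : P ∣ℤ Y * Y⁻¹ - 1ℤ
          P∣YY⁻¹-1 = proj₂ (inverse-mod P∤Y)
          rearrange : ∀ A X B Y Y⁻¹ →
            -1ℤ * A * B - A * X * Y⁻¹ * (A * X * Y⁻¹)
              ≡ A * B * (Y * Y⁻¹ + 1ℤ) * (Y * Y⁻¹ - 1ℤ) + - (A * (Y⁻¹ * Y⁻¹)) * (A * (X * X) + B * (Y * Y))
          rearrange = solve-∀
      by-cases (yes P∣Y) = [ ⊥-elim ∘ P∤A , P∣m*m⇒P∣m ]′ (P∣m*n⇒P∣m⊎P∣n {A} {X * X} P∣AX²) , P∣Y , P∣Z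
        where
          isolate-AX² : ∀ A X B Y → A * (X * X) ≡ (A * (X * X) + B * (Y * Y)) - B * (Y * Y)
          isolate-AX² = solve-∀
          P∣AX² : P ∣ℤ A * (X * X)
          P∣AX² = ∣-by-difference _ F (B * (Y * Y)) (isolate-AX² A X B Y) P∣F
                                  (ℤ∣.∣n⇒∣m*n B (ℤ∣.∣n⇒∣m*n Y P∣Y))

  ¬solvable-Pu-v : ∀ {u v} → ¬ P ∣ℤ seq u 1 → ¬ Square (seq v 1) → ¬ Solvable (P · u) v
  ¬solvable-Pu-v {u} {v} P∤u₁ ¬□v₁ (solvable x y z nontrivial solves) =
    nontrivial (descent (λ k → P * seq u k) (seq v) x y z solves step)
    where
      step : ∀ K → 1 ≤ K → ∀ X Y Z → P * P ∣ℤ P * seq u K * (X * X) + seq v K * (Y * Y) - Z * Z →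
             P ∣ℤ X × P ∣ℤ Y × P ∣ℤ Z
      step (suc K) _ X Y Z =
        P²∣PAX²+BY²-Z²⇒P∣XYZ (seq u (suc K)) (seq v (suc K)) X Y Z (P∤seq₁⇒P∤seq {u} P∤u₁ K)
                             (¬□v₁ ∘ Square-resp {seq v (suc K)} {seq v 1} (seq-coh-1 v K))

  ¬solvable-Pu-Pv : ∀ {u v} → ¬ P ∣ℤ seq u 1 → ¬ Square (-1ℤ * seq u 1 * seq v 1) → ¬ Solvable (P · u) (P · v)
  ¬solvable-Pu-Pv {u} {v} P∤u₁ ¬□-u₁v₁ (solvable x y z nontrivial solves) =
    nontrivial (descent (λ k → P * seq u k) (λ k → P * seq v k) x y z solves step)
    where
      perturb : ∀ u u₁ v v₁ → -1ℤ * u * v - -1ℤ * u₁ * v₁ ≡ (- v) * (u - u₁) + (- u₁) * (v - v₁)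
      perturb = solve-∀
      step : ∀ K → 1 ≤ K → ∀ X Y Z → P * P ∣ℤ P * seq u K * (X * X) + P * seq v K * (Y * Y) - Z * Z →
             P ∣ℤ X × P ∣ℤ Y × P ∣ℤ Z
      step (suc K) _ X Y Z =
        P²∣PAX²+PBY²-Z²⇒P∣XYZ (seq u (suc K)) (seq v (suc K)) X Y Z (P∤seq₁⇒P∤seq {u} P∤u₁ K)
          (¬□-u₁v₁ ∘ Square-resp { -1ℤ * seq u (suc K) * seq v (suc K)} { -1ℤ * seq u 1 * seq v 1}
                       (∣-by-combination₂ _ (- seq v (suc K)) (seq u (suc K) - seq u 1)
                                            (- seq u 1) (seq v (suc K) - seq v 1)
                                            (perturb (seq u (suc K)) (seq u 1) (seq v (suc K)) (seq v 1))
                                            (seq-coh-1 u K) (seq-coh-1 v K)))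

  Solvable-Pu-v⇔Square : ∀ {u v} → ¬ P ∣ℤ seq u 1 → ¬ P ∣ℤ seq v 1 → Solvable (P · u) v ⇔ Square (seq v 1)
  Solvable-Pu-v⇔Square {u} {v} P∤u₁ P∤v₁ =
    mk⇔ (λ sol → decidable-stable (Square? (seq v 1)) (λ ¬□v₁ → ¬solvable-Pu-v {u} {v} P∤u₁ ¬□v₁ sol))
        (solvable-Pu-v {u} {v} P∤v₁)

  Solvable-Pu-Pv⇔Square : ∀ {u v} → ¬ P ∣ℤ seq u 1 → ¬ P ∣ℤ seq v 1 →
                          Solvable (P · u) (P · v) ⇔ Square (-1ℤ * seq u 1 * seq v 1)
  Solvable-Pu-Pv⇔Square {u} {v} P∤u₁ P∤v₁ =
    mk⇔ (λ sol → decidable-stable (Square? (-1ℤ * seq u 1 * seq v 1))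
                                  (λ ¬□ → ¬solvable-Pu-Pv {u} {v} P∤u₁ ¬□ sol))
        (solvable-Pu-Pv {u} {v} P∤u₁ P∤v₁)

  -- The Hilbert symbol of p-adic integers

  HilbertSolvable-p⇔Square : ∀ {v} → ¬ P ∣ℤ seq v 1 → HilbertSolvable v (ι p P) ⇔ Square (seq v 1)
  HilbertSolvable-p⇔Square {v} P∤v₁ = begin
    HilbertSolvable v (ι p P)  ≈⟨ HilbertSolvable⇔Solvable ⟩
    Solvable v (ι p P)         ≈⟨ Solvable-resp-≈⇔ (≈-refl {v}) ιP≈P·ι1 ⟩
    Solvable v (P · ι p 1ℤ)    ≈⟨ Solvable-comm⇔ ⟩
    Solvable (P · ι p 1ℤ) v    ≈⟨ Solvable-Pu-v⇔Square {ι p 1ℤ} {v} P∤1 P∤v₁ ⟩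
    Square (seq v 1)           ∎
    where
      open ⇔-Reasoning
      ιP≈P·ι1 : ι p P ≈ P · ι p 1ℤ
      ιP≈P·ι1 = mk≈ λ k → subst (λ a → P^ k ∣ℤ P - a) (sym (Intₚ.*-identityʳ P)) (∣-diff-refl P)

  Sign-symbol-p : ∀ {v s} → ¬ P ∣ℤ seq v 1 → IsHilbertSymbol v (ι p P) s → Sign s (Square (seq v 1))
  Sign-symbol-p {v} P∤v₁ = Sign-resp-⇔ (HilbertSolvable-p⇔Square {v} P∤v₁)

  hilbertSymbol-p^λu : ∀ (a b u v : ℤₚ p) la lb {s su sv sm} →
    IsUnit u → IsUnit v → IsPowTimes a la u → IsPowTimes b lb v →
    IsHilbertSymbol a b s → IsHilbertSymbol u (ι p P) su → IsHilbertSymbol v (ι p P) sv →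
    IsHilbertSymbol (ι p -1ℤ) (ι p P) sm →
    s ≡ pow01 sm (isOdd la ∧ isOdd lb) * pow01 sv (isOdd la) * pow01 su (isOdd lb)
  hilbertSymbol-p^λu a b u v la lb {s} {su} {sv} {sm} u-unit v-unit a≡p^λu b≡p^λv Hs Hu Hv Hm =
    by-parity (isOdd la) (isOdd lb) to-parity
    where
      P∤u₁ = IsUnit⇒P∤seq₁ {u} u-unit
      P∤v₁ = IsUnit⇒P∤seq₁ {v} v-unit
      P∤-u₁ = P∤m⇒P∤n⇒P∤m*n { -1ℤ} {seq u 1} P∤-1 P∤u₁

      to-parity : HilbertSolvable a b ⇔ Solvable (P^bit (isOdd la) · u) (P^bit (isOdd lb) · v)
      to-parity = begin
        HilbertSolvable a b                                      ≈⟨ HilbertSolvable⇔Solvable ⟩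
        Solvable a b                                             ≈⟨ Solvable-resp-≈⇔ a≈p^λu b≈p^λv ⟩
        Solvable (P^ la · u) (P^ lb · v)                         ≈⟨ Solvable-parity la lb u v ⟩
        Solvable (P^bit (isOdd la) · u) (P^bit (isOdd lb) · v)   ∎
        where
          open ⇔-Reasoning
          a≈p^λu = mk≈ (ℤ∣.∣ᵤ⇒∣ ∘ a≡p^λu)
          b≈p^λv = mk≈ (ℤ∣.∣ᵤ⇒∣ ∘ b≡p^λv)

      □-1 : Sign sm (Square -1ℤ)
      □-1 = Sign-symbol-p {ι p -1ℤ} P∤-1 Hm
      □u : Sign su (Square (seq u 1))
      □u = Sign-symbol-p {u} P∤u₁ Hu
      □v : Sign sv (Square (seq v 1))
      □v = Sign-symbol-p {v} P∤v₁ Hv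
      □-u : Sign (sm * su) (Square (-1ℤ * seq u 1))
      □-u = Sign-resp-⇔ (⇔-sym (Square-*⇔ { -1ℤ} {seq u 1} P∤-1 P∤u₁)) (Sign-* □-1 □u)
      □-uv : Sign (sm * su * sv) (Square (-1ℤ * seq u 1 * seq v 1))
      □-uv = Sign-resp-⇔ (⇔-sym (Square-*⇔ { -1ℤ * seq u 1} {seq v 1} P∤-u₁ P∤v₁)) (Sign-* □-u □v)

      by-parity : ∀ oa ob → HilbertSolvable a b ⇔ Solvable (P^bit oa · u) (P^bit ob · v) →
                  s ≡ pow01 sm (oa ∧ ob) * pow01 sv oa * pow01 su ob
      by-parity false false H⇔ = Sign-true (Equivalence.from H⇔ (solvable-units {u} {v} P∤u₁ P∤v₁)) Hs
      by-parity true false H⇔ =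
        trans (Sign-unique (Solvable-Pu-v⇔Square {u} {v} P∤u₁ P∤v₁ ⇔-∘ H⇔) Hs □v)
              (sym (trans (Intₚ.*-identityʳ (1ℤ * sv)) (Intₚ.*-identityˡ sv)))
      by-parity false true H⇔ =
        trans (Sign-unique ((Solvable-Pu-v⇔Square {v} {u} P∤v₁ P∤u₁ ⇔-∘ Solvable-comm⇔) ⇔-∘ H⇔) Hs □u)
              (sym (Intₚ.*-identityˡ su))
      by-parity true true H⇔ =
        trans (Sign-unique (Solvable-Pu-Pv⇔Square {u} {v} P∤u₁ P∤v₁ ⇔-∘ H⇔) Hs □-uv) (swap sm su sv)
        where
          swap : ∀ a b c → a * b * c ≡ a * c * b
          swap = solve-∀


lemma5p5 : (n m : ℕ) → 2 ≤ n → 1 ≤ m →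
    (S : Encodings m n) → PairwiseCoprime S →
    (p : ℕ) → Prime p → ¬ (2 ∣ p) →
    (f : Fin n → Elt n) →
    (∀ j → InV S j (f j)) →
    (∀ j → memb j (f j) ≡ false) →
    (∀ i j → memb i (f j) ≡ memb j (f i)) →
    (t : Fin n → ℤₚ p) (λ' : Fin n → ℕ) (u : Fin n → ℤₚ p) →
    (∀ i → IsUnit (u i)) →
    (∀ i → IsPowTimes (t i) (λ' i) (u i)) →
    (hs : Fin n → Fin n → ℤ) → (∀ i j → IsHilbertSymbol (t i) (t j) (hs i j)) →
    (hm : ℤ) → IsHilbertSymbol (ι p -1ℤ) (ι p (+ p)) hm →
    (hu : Fin n → ℤ) → (∀ i → IsHilbertSymbol (u i) (ι p (+ p)) (hu i)) →
    prodPairs n (λ i j → pow01 (hs i j) (memb i (f j)))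
      ≡ prodPairs n (λ i j → pow01 hm (isOdd (λ' i) ∧ isOdd (λ' j) ∧ memb i (f j)))
        * prodFin n (λ i → pow01 (hu i) (xorSum n (λ j → isOdd (λ' j) ∧ memb i (f j))))
lemma5p5 n _ _ _ _ _ p p-prime p-odd f _ f-diag f-sym t λ' u u-unit t≡p^λu hs hs-symbol hm hm-symbol hu hu-symbol =
  trans (prodPairs-cong n λ i j → cong (λ s → pow01 s (memb i (f j))) (pairwise i j))
        (prodPairs-regroup-symbols n odd (λ i j → memb i (f j)) hm hu (λ i → Sign⇒s*s≡1 (hu-symbol i)) f-sym f-diag)
  where
    open OddPrime p p-prime p-odd
    odd : Fin n → Bool
    odd i = isOdd (λ' i)
    pairwise : ∀ i j → hs i j ≡ pow01 hm (odd i ∧ odd j) * pow01 (hu j) (odd i) * pow01 (hu i) (odd j)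
    pairwise i j = hilbertSymbol-p^λu (t i) (t j) (u i) (u j) (λ' i) (λ' j) (u-unit i) (u-unit j)
                                      (t≡p^λu i) (t≡p^λu j) (hs-symbol i j) (hu-symbol i) (hu-symbol j) hm-symbol
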